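{- Let $S = S(\lambda_1, \dots, \lambda_d)$ be a spider with an even number $n=1+\lambda_1+\cdots+\lambda_d$ of vertices, and let $j$ be the number of legs of odd length (necessarily $j$ is odd). Then $[e_{(2^{n/2})}]X_S = (-1)^{\frac{j-1}{2}}\cdot 2$.
   Context: For positive integers $\lambda_1 \geq \cdots \geq \lambda_d$, the spider $S(\lambda_1,\ldots,\lambda_d)$ is the tree consisting of a center vertex $v$ together with $d$ paths ("legs") having $\lambda_1,\ldots,\lambda_d$ vertices respectively (the length of a leg is its number of vertices), each attached to $v$ by an edge at one of its endpoints. The chromatic symmetric function is $X_G=\sum_\kappa \prod_{u\in V(G)} x_{\kappa(u)}$ over proper colorings $\kappa:V(G)\to\{1,2,\ldots\}$; $e_\lambda=e_{\lambda_1}\cdots e_{\lambda_\ell}$ with $e_k=\sum_{j_1<\cdots<j_k}x_{j_1}\cdots x_{j_k}$, and $[e_\lambda]X_G$ denotes the coefficient of $e_\lambda$ in the expansion of $X_G$ in the basis $\{e_\lambda\}$; $(2^{k})$ is the partition with $k$ parts equal to $2$. -}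

module Defs where

open import Data.Bool using (Bool; true; false; not; if_then_else_)
open import Data.Nat as ℕ using (ℕ; zero; suc; _∸_; _≥_; _≡ᵇ_; _⊓_)
open import Data.Integer as ℤ using (ℤ; +_; -_)
open import Data.List using (List; []; _∷_; map; concatMap; upTo; _++_; foldr)
open import Data.List.Relation.Unary.Linked using (Linked)
open import Data.Product using (_×_; _,_)
open import Relation.Binary.PropositionalEquality using (_≡_)

sumℕ : List ℕ → ℕ
sumℕ = foldr ℕ._+_ 0

sumℤ : List ℤ → ℤ
sumℤ = foldr ℤ._+_ (+ 0)

prodℤ : List ℤ → ℤ
prodℤ = foldr ℤ._*_ (+ 1)

allB : {A : Set} → (A → Bool) → List A → Bool
allB p [] = true
allB p (a ∷ as) = if p a then allB p as else false

-- Partitions of n: nonincreasing lists of positive integers summing to n.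
-- partsF fuel m n = all partitions of n with every part ≤ m.
partsF : ℕ → ℕ → ℕ → List (List ℕ)
partsF _ _ zero = [] ∷ []
partsF zero _ (suc n) = []
partsF (suc f) m (suc n) =
  concatMap (λ k → map (suc k ∷_) (partsF f (suc k) (suc n ∸ suc k)))
            (upTo (m ⊓ suc n))

partitions : ℕ → List (List ℕ)
partitions n = partsF n n n

-- Polynomials in the N variables x_0, …, x_{N-1} are represented by their
-- evaluation at x : ℕ → ℤ (only x 0 … x (N-1) are read).

elem : ℕ → ℕ → (ℕ → ℤ) → ℤ
elem zero    _       x = + 1
elem (suc k) zero    x = + 0
elem (suc k) (suc N) x = elem (suc k) N x ℤ.+ (x N ℤ.* elem k N x)

eλ : List ℕ → ℕ → (ℕ → ℤ) → ℤ
eλ μ N x = prodℤ (map (λ k → elem k N x) μ)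

-- Graphs on vertex set {0,…,n-1} given by an edge list.
-- A colouring is a list of length n of colours in {0,…,N-1}.

colourings : ℕ → ℕ → List (List ℕ)
colourings zero    N = [] ∷ []
colourings (suc l) N = concatMap (λ c → map (c ∷_) (colourings l N)) (upTo N)

at : List ℕ → ℕ → ℕ
at []       _       = 0
at (c ∷ cs) zero    = c
at (c ∷ cs) (suc i) = at cs i

proper : List (ℕ × ℕ) → List ℕ → Bool
proper E κ = allB (λ { (u , v) → not (at κ u ≡ᵇ at κ v) }) E

chromX : List (ℕ × ℕ) → ℕ → ℕ → (ℕ → ℤ) → ℤ
chromX E n N x =
  sumℤ (map (λ κ → if proper E κ then prodℤ (map x κ) else + 0) (colourings n N))

-- c is an e-expansion of X_G (G with n vertices, edges E), as an identity of
-- polynomials in n variables (n variables suffice for degree-n symmetric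
-- functions: the e_μ, μ ⊢ n, remain linearly independent).
IsEExpansion : List (ℕ × ℕ) → ℕ → (List ℕ → ℤ) → Set
IsEExpansion E n c =
  ∀ (x : ℕ → ℤ) → chromX E n n x ≡ sumℤ (map (λ μ → c μ ℤ.* eλ μ n x) (partitions n))

-- Spiders. Vertex 0 is the centre; the legs occupy consecutive blocks
-- of vertices 1.., each leg a path whose first vertex is adjacent to 0.

legEdges : ℕ → ℕ → List (ℕ × ℕ)
legEdges s zero = []
legEdges s (suc zero) = []
legEdges s (suc (suc l)) = (s , suc s) ∷ legEdges (suc s) (suc l)

spiderEdgesFrom : ℕ → List ℕ → List (ℕ × ℕ)
spiderEdgesFrom off [] = []
spiderEdgesFrom off (l ∷ ls) = ((0 , off) ∷ legEdges off l) ++ spiderEdgesFrom (off ℕ.+ l) ls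

spiderEdges : List ℕ → List (ℕ × ℕ)
spiderEdges ls = spiderEdgesFrom 1 ls

spiderSize : List ℕ → ℕ
spiderSize ls = suc (sumℕ ls)

oddLegs : List ℕ → ℕ
oddLegs [] = 0
oddLegs (l ∷ ls) = (if l ℕ.% 2 ≡ᵇ 1 then 1 else 0) ℕ.+ oddLegs ls

Nonincreasing : List ℕ → Set
Nonincreasing = Linked _≥_

negOnePow : ℕ → ℤ
negOnePow zero = + 1
negOnePow (suc m) = - negOnePow m

-- Uniqueness: at x = (1, −1, 0, …, 0) we have e₁ = 0, e₂ = −1 and eₘ = 0 for m ≥ 3, so every e_μ with
-- μ ⊢ n = 2k vanishes there except e_(2ᵏ) = (−1)ᵏ, and the coefficient is read off from X_S(1, −1, 0, …).
-- Only the two proper 2-colourings of the bipartite spider contribute: with the centre coloured 0 a leg of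
-- length l has weight (−1)^⌈l/2⌉, with the centre coloured 1 it has weight (−1)^⌊l/2⌋. Hence
-- X_S(1, −1, 0, …) = (−1)^(a+j) − (−1)^a where a = Σ ⌊l/2⌋, and n = 1 + 2a + j forces j to be odd.
--
-- Existence: conditioning on the colour c of the centre, X_S = Σ_c x_c ∏ L_l(c), where L_l(c) is the weighted
-- count of colourings of a leg whose first vertex avoids c. As L_{h+1}(c) = P_{h+1} − x_c L_h(c), with P_m the
-- chromatic function of a path, the sums Σ_c x_c^a ∏ L_l(c) reduce, leg by leg, to paths and power sums p_a.
-- Writing x̂_c for x with x_c set to 0, e_{j+1}(x) = e_{j+1}(x̂_c) + x_c e_j(x̂_c) gives
-- Σ_c x_c e_j(x̂_c) = (j+1) e_{j+1} and Σ_c x_c^(a+1) e_j(x̂_c) = p_a e_{j+1} − Σ_c x_c^a e_{j+1}(x̂_c),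
-- so every p_a, and with it X_S, is a polynomial in the e_k.

module Submission where

open import Defs

open import Algebra.Bundles using (CommutativeMonoid)
open import Data.Bool using (Bool; true; false; not; if_then_else_; _∧_)
open import Data.Empty using (⊥-elim)
open import Data.Integer as ℤ using (ℤ; +_; -_; _+_; _*_; _-_; _^_)
import Data.Integer.Properties as ℤₚ
open import Data.Integer.Tactic.RingSolver using (solve-∀)
open import Data.List using (List; []; _∷_; map; concatMap; upTo; _++_; [_]; length; replicate)
open import Data.List.Properties using (upTo-∷ʳ; map-++)
open import Data.List.Relation.Binary.Permutation.Propositional using (_↭_; ↭⇒↭ₛ; ↭-sym)
import Data.List.Relation.Binary.Permutation.Propositional.Properties as ↭
open import Data.List.Relation.Binary.Permutation.Setoid.Properties using (foldr-commMonoid)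
open import Data.List.Relation.Unary.All as All using (All; []; _∷_)
open import Data.List.Relation.Unary.All.Properties using (++⁺; map⁺; concat⁺; applyUpTo⁺₁)
open import Data.List.Relation.Unary.Linked using ([]; [-]; _∷_)
open import Data.Nat as ℕ using (ℕ; zero; suc; _≡ᵇ_; _<_; _≤_; z≤n; s≤s; _∸_; _⊓_; _/_; _%_; ⌊_/2⌋; ⌈_/2⌉)
open import Data.Nat.ListAction.Properties using (sum-↭)
import Data.Nat.DivMod as ℕ
import Data.Nat.Properties as ℕₚ
import Data.Nat.Tactic.RingSolver as ℕ-Solver
open import Data.Product using (Σ; _×_; _,_; proj₁; proj₂)
open import Data.Sum using (inj₁; inj₂)
open import Function using (_∘_)
import Relation.Binary.Construct.Flip.EqAndOrd as Flip
open import Data.List.Sort (Flip.decTotalOrder ℕₚ.≤-decTotalOrder) using (sort; sort-↭; sort-↗)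
open import Relation.Binary.PropositionalEquality hiding ([_])
open import Relation.Nullary.Decidable using (dec-true; dec-false)
open ≡-Reasoning

∑∈ : {A : Set} → List A → (A → ℤ) → ℤ
∑∈ xs f = sumℤ (map f xs)

infix 5 ∑∈ ∑<

syntax ∑∈ xs (λ a → f) = ∑[ a ∈ xs ] f

∑< : ℕ → (ℕ → ℤ) → ℤ
∑< zero    f = + 0
∑< (suc n) f = ∑< n f + f n

syntax ∑< n (λ i → f) = ∑[ i < n ] f

private variable A B : Set

∑∈-++ : ∀ (xs ys : List A) (f : A → ℤ) → ∑∈ (xs ++ ys) f ≡ ∑∈ xs f + ∑∈ ys f
∑∈-++ [] ys f = sym (ℤₚ.+-identityˡ _)
∑∈-++ (a ∷ xs) ys f = trans (cong (_+_ (f a)) (∑∈-++ xs ys f)) (sym (ℤₚ.+-assoc (f a) _ _))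

∑∈-cong : ∀ (xs : List A) {f g : A → ℤ} → (∀ a → f a ≡ g a) → ∑∈ xs f ≡ ∑∈ xs g
∑∈-cong []       e = refl
∑∈-cong (a ∷ xs) e = cong₂ _+_ (e a) (∑∈-cong xs e)

∑∈-cong-All : ∀ {P : A → Set} (xs : List A) {f g : A → ℤ} → All P xs →
  (∀ a → P a → f a ≡ g a) → ∑∈ xs f ≡ ∑∈ xs g
∑∈-cong-All []       []       e = refl
∑∈-cong-All (a ∷ xs) (p ∷ ps) e = cong₂ _+_ (e a p) (∑∈-cong-All xs ps e)

∑∈-0 : ∀ (xs : List A) → ∑[ a ∈ xs ] + 0 ≡ + 0
∑∈-0 []       = refl
∑∈-0 (a ∷ xs) = trans (ℤₚ.+-identityˡ _) (∑∈-0 xs)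

∑∈-+ : ∀ (xs : List A) (f g : A → ℤ) → ∑[ a ∈ xs ] (f a + g a) ≡ ∑∈ xs f + ∑∈ xs g
∑∈-+ []       f g = refl
∑∈-+ (a ∷ xs) f g = trans (cong (_+_ (f a + g a)) (∑∈-+ xs f g)) (interchange (f a) (g a) _ _)
  where
  interchange : ∀ p q r s → p + q + (r + s) ≡ p + r + (q + s)
  interchange = solve-∀

∑∈-*ˡ : ∀ (xs : List A) (c : ℤ) (f : A → ℤ) → ∑[ a ∈ xs ] (c * f a) ≡ c * ∑∈ xs f
∑∈-*ˡ []       c f = sym (ℤₚ.*-zeroʳ c)
∑∈-*ˡ (a ∷ xs) c f = trans (cong (_+_ (c * f a)) (∑∈-*ˡ xs c f)) (sym (ℤₚ.*-distribˡ-+ c (f a) _))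

∑∈-*ʳ : ∀ (xs : List A) (c : ℤ) (f : A → ℤ) → ∑[ a ∈ xs ] (f a * c) ≡ ∑∈ xs f * c
∑∈-*ʳ []       c f = refl
∑∈-*ʳ (a ∷ xs) c f = trans (cong (_+_ (f a * c)) (∑∈-*ʳ xs c f)) (sym (ℤₚ.*-distribʳ-+ c (f a) _))

∑∈-map : (g : A → B) (xs : List A) (f : B → ℤ) → ∑∈ (map g xs) f ≡ ∑∈ xs (f ∘ g)
∑∈-map g []       f = refl
∑∈-map g (a ∷ xs) f = cong (_+_ (f (g a))) (∑∈-map g xs f)

∑∈-concatMap : (g : A → List B) (xs : List A) (f : B → ℤ) →
  ∑∈ (concatMap g xs) f ≡ ∑[ a ∈ xs ] ∑∈ (g a) f
∑∈-concatMap g []       f = refl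
∑∈-concatMap g (a ∷ xs) f =
  trans (∑∈-++ (g a) (concatMap g xs) f) (cong (_+_ (∑∈ (g a) f)) (∑∈-concatMap g xs f))

∑∈-comm : (xs : List A) (ys : List B) (h : A → B → ℤ) →
  ∑[ a ∈ xs ] ∑[ b ∈ ys ] h a b ≡ ∑[ b ∈ ys ] ∑[ a ∈ xs ] h a b
∑∈-comm []       ys h = sym (∑∈-0 ys)
∑∈-comm (a ∷ xs) ys h =
  trans (cong (_+_ (∑∈ ys (h a))) (∑∈-comm xs ys h)) (sym (∑∈-+ ys (h a) _))

∑∈-product : (xs : List A) (ys : List B) (g : A → ℤ) (h : B → ℤ) →
  ∑[ a ∈ xs ] ∑[ b ∈ ys ] (g a * h b) ≡ ∑∈ xs g * ∑∈ ys h
∑∈-product xs ys g h =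
  trans (∑∈-cong xs (λ a → ∑∈-*ˡ ys (g a) h)) (∑∈-*ʳ xs (∑∈ ys h) g)

∑∈-upTo : ∀ n (f : ℕ → ℤ) → ∑∈ (upTo n) f ≡ ∑< n f
∑∈-upTo zero    f = refl
∑∈-upTo (suc n) f = begin
  ∑∈ (upTo (suc n)) f       ≡⟨ cong (λ xs → ∑∈ xs f) (upTo-∷ʳ n) ⟨
  ∑∈ (upTo n ++ [ n ]) f    ≡⟨ ∑∈-++ (upTo n) [ n ] f ⟩
  ∑∈ (upTo n) f + (f n + + 0) ≡⟨ cong₂ _+_ (∑∈-upTo n f) (ℤₚ.+-identityʳ (f n)) ⟩
  ∑< n f + f n              ∎

∑<-cong : ∀ n {f g : ℕ → ℤ} → (∀ i → i < n → f i ≡ g i) → ∑< n f ≡ ∑< n g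
∑<-cong zero    e = refl
∑<-cong (suc n) e = cong₂ _+_ (∑<-cong n (λ i i<n → e i (ℕₚ.m<n⇒m<1+n i<n))) (e n ℕₚ.≤-refl)

∑<-0 : ∀ n → ∑[ i < n ] + 0 ≡ + 0
∑<-0 zero    = refl
∑<-0 (suc n) = trans (ℤₚ.+-identityʳ _) (∑<-0 n)

∑<-+ : ∀ n (f g : ℕ → ℤ) → ∑[ i < n ] (f i + g i) ≡ ∑< n f + ∑< n g
∑<-+ zero    f g = refl
∑<-+ (suc n) f g = trans (cong (_+ (f n + g n)) (∑<-+ n f g)) (interchange (∑< n f) (∑< n g) (f n) (g n))
  where
  interchange : ∀ p q r s → p + q + (r + s) ≡ p + r + (q + s)
  interchange = solve-∀

∑<-*ˡ : ∀ n (c : ℤ) (f : ℕ → ℤ) → ∑[ i < n ] (c * f i) ≡ c * ∑< n f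
∑<-*ˡ zero    c f = sym (ℤₚ.*-zeroʳ c)
∑<-*ˡ (suc n) c f = trans (cong (_+ c * f n) (∑<-*ˡ n c f)) (sym (ℤₚ.*-distribˡ-+ c _ (f n)))

∑<-neg : ∀ n (f : ℕ → ℤ) → ∑[ i < n ] (- f i) ≡ - ∑< n f
∑<-neg zero    f = refl
∑<-neg (suc n) f = trans (cong (_+ - f n) (∑<-neg n f)) (sym (ℤₚ.neg-distrib-+ (∑< n f) (f n)))

∑<-δ : ∀ n k (f : ℕ → ℤ) → k < n → (∀ i → i < n → i ≢ k → f i ≡ + 0) → ∑< n f ≡ f k
∑<-δ (suc n) k f k<1+n vanish with ℕₚ.m≤n⇒m<n∨m≡n (ℕₚ.≤-pred k<1+n)
... | inj₂ refl = trans (cong (_+ f k) (trans (∑<-cong n (λ i i<n → vanish i (ℕₚ.m<n⇒m<1+n i<n) (ℕₚ.<⇒≢ i<n)))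
                                              (∑<-0 n)))
                        (ℤₚ.+-identityˡ (f k))
... | inj₁ k<n  = trans (cong₂ _+_ (∑<-δ n k f k<n (λ i i<n → vanish i (ℕₚ.m<n⇒m<1+n i<n)))
                                   (vanish n ℕₚ.≤-refl (ℕₚ.<⇒≢ k<n ∘ sym)))
                        (ℤₚ.+-identityʳ (f k))

∑<-first-two : ∀ n → 2 ≤ n → (f : ℕ → ℤ) → (∀ i → f (suc (suc i)) ≡ + 0) → ∑< n f ≡ f 0 + f 1
∑<-first-two (suc zero)          (s≤s ()) f vanish
∑<-first-two (suc (suc zero))    _ f vanish = cong (_+ f 1) (ℤₚ.+-identityˡ (f 0))
∑<-first-two (suc (suc (suc n))) _ f vanish =
  trans (cong (_+_ (∑< (suc (suc n)) f)) (vanish n))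
        (trans (ℤₚ.+-identityʳ _) (∑<-first-two (suc (suc n)) (s≤s (s≤s z≤n)) f vanish))

∑-colourings-[] : ∀ N (f : List ℕ → ℤ) → ∑∈ (colourings 0 N) f ≡ f []
∑-colourings-[] N f = ℤₚ.+-identityʳ (f [])

∑-colourings-∷ : ∀ l N (f : List ℕ → ℤ) →
  ∑∈ (colourings (suc l) N) f ≡ ∑[ c < N ] ∑[ κ ∈ colourings l N ] f (c ∷ κ)
∑-colourings-∷ l N f = begin
  ∑∈ (concatMap (λ c → map (c ∷_) (colourings l N)) (upTo N)) f
    ≡⟨ ∑∈-concatMap (λ c → map (c ∷_) (colourings l N)) (upTo N) f ⟩
  ∑[ c ∈ upTo N ] ∑∈ (map (c ∷_) (colourings l N)) f
    ≡⟨ ∑∈-cong (upTo N) (λ c → ∑∈-map (c ∷_) (colourings l N) f) ⟩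
  ∑[ c ∈ upTo N ] ∑[ κ ∈ colourings l N ] f (c ∷ κ)
    ≡⟨ ∑∈-upTo N _ ⟩
  ∑[ c < N ] ∑[ κ ∈ colourings l N ] f (c ∷ κ) ∎

∑-colourings-cong : ∀ l N {f g : List ℕ → ℤ} → (∀ κ → length κ ≡ l → f κ ≡ g κ) →
  ∑∈ (colourings l N) f ≡ ∑∈ (colourings l N) g
∑-colourings-cong zero    N {f} {g} e =
  trans (∑-colourings-[] N f) (trans (e [] refl) (sym (∑-colourings-[] N g)))
∑-colourings-cong (suc l) N {f} {g} e = begin
  ∑∈ (colourings (suc l) N) f                   ≡⟨ ∑-colourings-∷ l N f ⟩
  ∑[ c < N ] ∑[ κ ∈ colourings l N ] f (c ∷ κ)  ≡⟨ ∑<-cong N (λ c _ → ∑-colourings-cong l N (λ κ eq → e (c ∷ κ) (cong suc eq))) ⟩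
  ∑[ c < N ] ∑[ κ ∈ colourings l N ] g (c ∷ κ)  ≡⟨ ∑-colourings-∷ l N g ⟨
  ∑∈ (colourings (suc l) N) g                   ∎

∑-colourings-++ : ∀ a b N (f : List ℕ → ℤ) →
  ∑∈ (colourings (a ℕ.+ b) N) f ≡ ∑[ ρ ∈ colourings a N ] ∑[ σ ∈ colourings b N ] f (ρ ++ σ)
∑-colourings-++ zero    b N f = sym (∑-colourings-[] N (λ ρ → ∑[ σ ∈ colourings b N ] f (ρ ++ σ)))
∑-colourings-++ (suc a) b N f = begin
  ∑∈ (colourings (suc (a ℕ.+ b)) N) f
    ≡⟨ ∑-colourings-∷ (a ℕ.+ b) N f ⟩
  ∑[ c < N ] ∑∈ (colourings (a ℕ.+ b) N) (λ κ → f (c ∷ κ))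
    ≡⟨ ∑<-cong N (λ c _ → ∑-colourings-++ a b N (λ κ → f (c ∷ κ))) ⟩
  ∑[ c < N ] ∑[ ρ ∈ colourings a N ] ∑[ σ ∈ colourings b N ] f (c ∷ ρ ++ σ)
    ≡⟨ ∑-colourings-∷ a N _ ⟨
  ∑[ ρ ∈ colourings (suc a) N ] ∑[ σ ∈ colourings b N ] f (ρ ++ σ) ∎

-- Colourings of a spider

weight : (ℕ → ℤ) → List ℕ → ℤ
weight x κ = prodℤ (map x κ)

weight-++ : ∀ x ρ σ → weight x (ρ ++ σ) ≡ weight x ρ * weight x σ
weight-++ x []      σ = sym (ℤₚ.*-identityˡ _)
weight-++ x (d ∷ ρ) σ = trans (cong (x d *_) (weight-++ x ρ σ)) (sym (ℤₚ.*-assoc (x d) _ _))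

𝟙 : Bool → ℤ
𝟙 true  = + 1
𝟙 false = + 0

𝟙-∧ : ∀ a b → 𝟙 (a ∧ b) ≡ 𝟙 a * 𝟙 b
𝟙-∧ true  true  = refl
𝟙-∧ true  false = refl
𝟙-∧ false b     = refl

if-then-0≡𝟙* : ∀ b (v : ℤ) → (if b then v else + 0) ≡ 𝟙 b * v
if-then-0≡𝟙* true  v = sym (ℤₚ.*-identityˡ v)
if-then-0≡𝟙* false v = sym (ℤₚ.*-zeroˡ v)

if-else-false≡∧ : ∀ a b → (if a then b else false) ≡ a ∧ b
if-else-false≡∧ true  b = refl
if-else-false≡∧ false b = refl

allB-++ : ∀ (p : A → Bool) xs ys → allB p (xs ++ ys) ≡ allB p xs ∧ allB p ys
allB-++ p []       ys = refl
allB-++ p (a ∷ xs) ys with p a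
... | true  = allB-++ p xs ys
... | false = refl

proper-++ : ∀ E F κ → proper (E ++ F) κ ≡ proper E κ ∧ proper F κ
proper-++ E F κ = allB-++ _ E F

at-++ : ∀ ρ σ i → at (ρ ++ σ) (length ρ ℕ.+ i) ≡ at σ i
at-++ []      σ i = refl
at-++ (d ∷ ρ) σ i = at-++ ρ σ i

proper-legEdges-∷ : ∀ s l d κ → proper (legEdges (suc s) l) (d ∷ κ) ≡ proper (legEdges s l) κ
proper-legEdges-∷ s zero          d κ = refl
proper-legEdges-∷ s (suc zero)    d κ = refl
proper-legEdges-∷ s (suc (suc l)) d κ =
  cong (λ b → if not (at κ s ≡ᵇ at κ (suc s)) then b else false) (proper-legEdges-∷ (suc s) (suc l) d κ)

proper-legEdges-++ˡ : ∀ ρ s l σ → proper (legEdges (length ρ ℕ.+ s) l) (ρ ++ σ) ≡ proper (legEdges s l) σ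
proper-legEdges-++ˡ []      s l σ = refl
proper-legEdges-++ˡ (d ∷ ρ) s l σ = trans (proper-legEdges-∷ (length ρ ℕ.+ s) l d (ρ ++ σ)) (proper-legEdges-++ˡ ρ s l σ)

proper-legEdges-++ʳ : ∀ l ρ σ → length ρ ≡ l → proper (legEdges 0 l) (ρ ++ σ) ≡ proper (legEdges 0 l) ρ
proper-legEdges-++ʳ zero          ρ            σ _  = refl
proper-legEdges-++ʳ (suc zero)    ρ            σ _  = refl
proper-legEdges-++ʳ (suc (suc l)) (d ∷ d′ ∷ ρ) σ eq =
  cong (λ b → if not (d ≡ᵇ d′) then b else false) (begin
    proper (legEdges 1 (suc l)) (d ∷ d′ ∷ ρ ++ σ) ≡⟨ proper-legEdges-∷ 0 (suc l) d (d′ ∷ ρ ++ σ) ⟩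
    proper (legEdges 0 (suc l)) (d′ ∷ ρ ++ σ)     ≡⟨ proper-legEdges-++ʳ (suc l) (d′ ∷ ρ) σ (ℕₚ.suc-injective eq) ⟩
    proper (legEdges 0 (suc l)) (d′ ∷ ρ)          ≡⟨ proper-legEdges-∷ 0 (suc l) d (d′ ∷ ρ) ⟨
    proper (legEdges 1 (suc l)) (d ∷ d′ ∷ ρ)      ∎)

proper-spiderEdgesFrom-++ˡ : ∀ ρ o ls c σ →
  proper (spiderEdgesFrom (suc (length ρ ℕ.+ o)) ls) (c ∷ ρ ++ σ) ≡ proper (spiderEdgesFrom (suc o) ls) (c ∷ σ)
proper-spiderEdgesFrom-++ˡ ρ o []       c σ = refl
proper-spiderEdgesFrom-++ˡ ρ o (l ∷ ls) c σ =
  cong₂ (λ a b → if not (c ≡ᵇ a) then b else false) (at-++ ρ σ o) (begin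
    proper (legEdges (suc m) l ++ spiderEdgesFrom (suc m ℕ.+ l) ls) (c ∷ ρ ++ σ)
      ≡⟨ proper-++ (legEdges (suc m) l) _ (c ∷ ρ ++ σ) ⟩
    proper (legEdges (suc m) l) (c ∷ ρ ++ σ) ∧ proper (spiderEdgesFrom (suc m ℕ.+ l) ls) (c ∷ ρ ++ σ)
      ≡⟨ cong₂ _∧_ leg rest ⟩
    proper (legEdges (suc o) l) (c ∷ σ) ∧ proper (spiderEdgesFrom (suc o ℕ.+ l) ls) (c ∷ σ)
      ≡⟨ proper-++ (legEdges (suc o) l) _ (c ∷ σ) ⟨
    proper (legEdges (suc o) l ++ spiderEdgesFrom (suc o ℕ.+ l) ls) (c ∷ σ) ∎)
  where
  m = length ρ ℕ.+ o
  leg : proper (legEdges (suc m) l) (c ∷ ρ ++ σ) ≡ proper (legEdges (suc o) l) (c ∷ σ)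
  leg = trans (proper-legEdges-∷ m l c (ρ ++ σ))
              (trans (proper-legEdges-++ˡ ρ o l σ) (sym (proper-legEdges-∷ o l c σ)))
  rest : proper (spiderEdgesFrom (suc m ℕ.+ l) ls) (c ∷ ρ ++ σ) ≡ proper (spiderEdgesFrom (suc o ℕ.+ l) ls) (c ∷ σ)
  rest = trans (cong (λ i → proper (spiderEdgesFrom (suc i) ls) (c ∷ ρ ++ σ)) (ℕₚ.+-assoc (length ρ) o l))
               (proper-spiderEdgesFrom-++ˡ ρ (o ℕ.+ l) ls c σ)

proper-spider-∷ : ∀ l ls c ρ σ → length ρ ≡ suc l →
  proper (spiderEdgesFrom 1 (suc l ∷ ls)) (c ∷ ρ ++ σ)
    ≡ not (c ≡ᵇ at ρ 0) ∧ (proper (legEdges 0 (suc l)) ρ ∧ proper (spiderEdgesFrom 1 ls) (c ∷ σ))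
proper-spider-∷ l ls c (d ∷ ρ) σ eq = begin
  (if not (c ≡ᵇ d) then proper (legEdges 1 (suc l) ++ spiderEdgesFrom (2 ℕ.+ l) ls) (c ∷ d ∷ ρ ++ σ) else false)
    ≡⟨ if-else-false≡∧ (not (c ≡ᵇ d)) _ ⟩
  not (c ≡ᵇ d) ∧ proper (legEdges 1 (suc l) ++ spiderEdgesFrom (2 ℕ.+ l) ls) (c ∷ d ∷ ρ ++ σ)
    ≡⟨ cong (not (c ≡ᵇ d) ∧_) (proper-++ (legEdges 1 (suc l)) _ (c ∷ d ∷ ρ ++ σ)) ⟩
  not (c ≡ᵇ d) ∧ (proper (legEdges 1 (suc l)) (c ∷ d ∷ ρ ++ σ) ∧ proper (spiderEdgesFrom (2 ℕ.+ l) ls) (c ∷ d ∷ ρ ++ σ))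
    ≡⟨ cong (λ b → not (c ≡ᵇ d) ∧ b) (cong₂ _∧_ leg rest) ⟩
  not (c ≡ᵇ d) ∧ (proper (legEdges 0 (suc l)) (d ∷ ρ) ∧ proper (spiderEdgesFrom 1 ls) (c ∷ σ)) ∎
  where
  leg : proper (legEdges 1 (suc l)) (c ∷ d ∷ ρ ++ σ) ≡ proper (legEdges 0 (suc l)) (d ∷ ρ)
  leg = trans (proper-legEdges-∷ 0 (suc l) c (d ∷ ρ ++ σ)) (proper-legEdges-++ʳ (suc l) (d ∷ ρ) σ eq)
  rest : proper (spiderEdgesFrom (2 ℕ.+ l) ls) (c ∷ d ∷ ρ ++ σ) ≡ proper (spiderEdgesFrom 1 ls) (c ∷ σ)
  rest = trans (cong (λ i → proper (spiderEdgesFrom (suc i) ls) (c ∷ d ∷ ρ ++ σ)) (sym (trans (ℕₚ.+-identityʳ _) eq)))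
               (proper-spiderEdgesFrom-++ˡ (d ∷ ρ) 0 ls c σ)

legWeight : ℕ → (ℕ → ℤ) → ℕ → ℕ → ℤ
legWeight N x zero    c = + 1
legWeight N x (suc l) c = ∑[ d < N ] 𝟙 (not (c ≡ᵇ d)) * (x d * legWeight N x l d)

legColouringWeight : (ℕ → ℤ) → ℕ → ℕ → List ℕ → ℤ
legColouringWeight x c l ρ = 𝟙 (not (c ≡ᵇ at ρ 0)) * (𝟙 (proper (legEdges 0 l) ρ) * weight x ρ)

legColouringWeight-∷ : ∀ x c d l ρ →
  legColouringWeight x c (suc (suc l)) (d ∷ ρ) ≡ 𝟙 (not (c ≡ᵇ d)) * x d * legColouringWeight x d (suc l) ρ
legColouringWeight-∷ x c d l ρ = begin
  𝟙 a * (𝟙 (if b then proper (legEdges 1 (suc l)) (d ∷ ρ) else false) * (x d * weight x ρ))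
    ≡⟨ cong (λ p → 𝟙 a * (𝟙 p * (x d * weight x ρ)))
            (trans (if-else-false≡∧ b _) (cong (b ∧_) (proper-legEdges-∷ 0 (suc l) d ρ))) ⟩
  𝟙 a * (𝟙 (b ∧ p) * (x d * weight x ρ))
    ≡⟨ cong (λ z → 𝟙 a * (z * (x d * weight x ρ))) (𝟙-∧ b p) ⟩
  𝟙 a * (𝟙 b * 𝟙 p * (x d * weight x ρ))
    ≡⟨ regroup (𝟙 a) (𝟙 b) (𝟙 p) (x d) (weight x ρ) ⟩
  𝟙 a * x d * (𝟙 b * (𝟙 p * weight x ρ)) ∎
  where
  a = not (c ≡ᵇ d)
  b = not (d ≡ᵇ at ρ 0)
  p = proper (legEdges 0 (suc l)) ρ
  regroup : ∀ u v w y z → u * (v * w * (y * z)) ≡ u * y * (v * (w * z))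
  regroup = solve-∀

legWeight-colourings : ∀ N x l c →
  ∑[ ρ ∈ colourings (suc l) N ] legColouringWeight x c (suc l) ρ ≡ legWeight N x (suc l) c
legWeight-colourings N x l c = trans (∑-colourings-∷ l N _) (∑<-cong N (λ d _ → firstColour l d))
  where
  firstColour : ∀ l d → ∑[ ρ ∈ colourings l N ] legColouringWeight x c (suc l) (d ∷ ρ)
                          ≡ 𝟙 (not (c ≡ᵇ d)) * (x d * legWeight N x l d)
  firstColour zero    d = trans (∑-colourings-[] N (λ ρ → legColouringWeight x c 1 (d ∷ ρ)))
                                (cong (𝟙 (not (c ≡ᵇ d)) *_) (ℤₚ.*-identityˡ (x d * + 1)))
  firstColour (suc l) d = begin
    ∑[ ρ ∈ colourings (suc l) N ] legColouringWeight x c (suc (suc l)) (d ∷ ρ)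
      ≡⟨ ∑∈-cong (colourings (suc l) N) (legColouringWeight-∷ x c d l) ⟩
    ∑[ ρ ∈ colourings (suc l) N ] 𝟙 (not (c ≡ᵇ d)) * x d * legColouringWeight x d (suc l) ρ
      ≡⟨ ∑∈-*ˡ (colourings (suc l) N) (𝟙 (not (c ≡ᵇ d)) * x d) _ ⟩
    𝟙 (not (c ≡ᵇ d)) * x d * (∑[ ρ ∈ colourings (suc l) N ] legColouringWeight x d (suc l) ρ)
      ≡⟨ cong (𝟙 (not (c ≡ᵇ d)) * x d *_) (legWeight-colourings N x l d) ⟩
    𝟙 (not (c ≡ᵇ d)) * x d * legWeight N x (suc l) d
      ≡⟨ ℤₚ.*-assoc (𝟙 (not (c ≡ᵇ d))) (x d) _ ⟩
    𝟙 (not (c ≡ᵇ d)) * (x d * legWeight N x (suc l) d) ∎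

legsWeight : ℕ → (ℕ → ℤ) → List ℕ → ℕ → ℤ
legsWeight N x ls c = prodℤ (map (λ l → legWeight N x l c) ls)

legsWeight-colourings : ∀ N x ls c → All (1 ≤_) ls →
  ∑[ σ ∈ colourings (sumℕ ls) N ] 𝟙 (proper (spiderEdgesFrom 1 ls) (c ∷ σ)) * weight x σ ≡ legsWeight N x ls c
legsWeight-colourings N x []           c []      = refl
legsWeight-colourings N x (suc l ∷ ls) c (_ ∷ ps) = begin
  ∑∈ (colourings (suc l ℕ.+ sumℕ ls) N) spider
    ≡⟨ ∑-colourings-++ (suc l) (sumℕ ls) N spider ⟩
  ∑[ ρ ∈ colourings (suc l) N ] ∑[ σ ∈ colourings (sumℕ ls) N ] spider (ρ ++ σ)
    ≡⟨ ∑-colourings-cong (suc l) N (λ ρ eq → ∑∈-cong (colourings (sumℕ ls) N) (split ρ eq)) ⟩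
  ∑[ ρ ∈ colourings (suc l) N ] ∑[ σ ∈ colourings (sumℕ ls) N ] legColouringWeight x c (suc l) ρ * rest σ
    ≡⟨ ∑∈-product (colourings (suc l) N) (colourings (sumℕ ls) N) (legColouringWeight x c (suc l)) rest ⟩
  ∑∈ (colourings (suc l) N) (legColouringWeight x c (suc l)) * ∑∈ (colourings (sumℕ ls) N) rest
    ≡⟨ cong₂ _*_ (legWeight-colourings N x l c) (legsWeight-colourings N x ls c ps) ⟩
  legWeight N x (suc l) c * legsWeight N x ls c ∎
  where
  spider rest : List ℕ → ℤ
  spider σ = 𝟙 (proper (spiderEdgesFrom 1 (suc l ∷ ls)) (c ∷ σ)) * weight x σ
  rest   σ = 𝟙 (proper (spiderEdgesFrom 1 ls) (c ∷ σ)) * weight x σ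
  regroup : ∀ a b h u v → a * (b * h) * (u * v) ≡ a * (b * u) * (h * v)
  regroup = solve-∀
  split : ∀ ρ → length ρ ≡ suc l → ∀ σ → spider (ρ ++ σ) ≡ legColouringWeight x c (suc l) ρ * rest σ
  split ρ eq σ = begin
    𝟙 (proper (spiderEdgesFrom 1 (suc l ∷ ls)) (c ∷ ρ ++ σ)) * weight x (ρ ++ σ)
      ≡⟨ cong₂ _*_ (cong 𝟙 (proper-spider-∷ l ls c ρ σ eq)) (weight-++ x ρ σ) ⟩
    𝟙 (a ∧ (b ∧ h)) * (weight x ρ * weight x σ)
      ≡⟨ cong (_* (weight x ρ * weight x σ)) (trans (𝟙-∧ a (b ∧ h)) (cong (𝟙 a *_) (𝟙-∧ b h))) ⟩
    𝟙 a * (𝟙 b * 𝟙 h) * (weight x ρ * weight x σ)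
      ≡⟨ regroup (𝟙 a) (𝟙 b) (𝟙 h) (weight x ρ) (weight x σ) ⟩
    legColouringWeight x c (suc l) ρ * rest σ ∎
    where
    a = not (c ≡ᵇ at ρ 0)
    b = proper (legEdges 0 (suc l)) ρ
    h = proper (spiderEdgesFrom 1 ls) (c ∷ σ)

spiderWeight : ℕ → (ℕ → ℤ) → ℕ → List ℕ → ℤ
spiderWeight N x a ls = ∑[ c < N ] x c ^ suc a * legsWeight N x ls c

chromX-spider : ∀ N x ls → All (1 ≤_) ls → chromX (spiderEdges ls) (spiderSize ls) N x ≡ spiderWeight N x 0 ls
chromX-spider N x ls ps = begin
  chromX (spiderEdges ls) (spiderSize ls) N x
    ≡⟨ ∑∈-cong (colourings (spiderSize ls) N) (λ κ → if-then-0≡𝟙* (proper (spiderEdges ls) κ) (weight x κ)) ⟩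
  ∑[ κ ∈ colourings (suc (sumℕ ls)) N ] 𝟙 (proper (spiderEdges ls) κ) * weight x κ
    ≡⟨ ∑-colourings-∷ (sumℕ ls) N _ ⟩
  ∑[ c < N ] ∑[ σ ∈ colourings (sumℕ ls) N ] 𝟙 (proper (spiderEdges ls) (c ∷ σ)) * (x c * weight x σ)
    ≡⟨ ∑<-cong N (λ c _ → centre c) ⟩
  spiderWeight N x 0 ls ∎
  where
  swap : ∀ a b w → a * (b * w) ≡ b * + 1 * (a * w)
  swap = solve-∀
  centre : ∀ c → ∑[ σ ∈ colourings (sumℕ ls) N ] 𝟙 (proper (spiderEdges ls) (c ∷ σ)) * (x c * weight x σ)
                   ≡ x c ^ 1 * legsWeight N x ls c
  centre c = begin
    ∑[ σ ∈ colourings (sumℕ ls) N ] 𝟙 (proper (spiderEdges ls) (c ∷ σ)) * (x c * weight x σ)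
      ≡⟨ ∑∈-cong (colourings (sumℕ ls) N) (λ σ → swap (𝟙 (proper (spiderEdges ls) (c ∷ σ))) (x c) (weight x σ)) ⟩
    ∑[ σ ∈ colourings (sumℕ ls) N ] x c ^ 1 * (𝟙 (proper (spiderEdges ls) (c ∷ σ)) * weight x σ)
      ≡⟨ ∑∈-*ˡ (colourings (sumℕ ls) N) (x c ^ 1) _ ⟩
    x c ^ 1 * (∑[ σ ∈ colourings (sumℕ ls) N ] 𝟙 (proper (spiderEdges ls) (c ∷ σ)) * weight x σ)
      ≡⟨ cong (x c ^ 1 *_) (legsWeight-colourings N x ls c ps) ⟩
    x c ^ 1 * legsWeight N x ls c ∎

≡ᵇ-refl : ∀ m → (m ≡ᵇ m) ≡ true
≡ᵇ-refl m = dec-true (m ℕ.≟ m) refl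

≡ᵇ-≢ : ∀ {m n} → m ≢ n → (m ≡ᵇ n) ≡ false
≡ᵇ-≢ {m} {n} = dec-false (m ℕ.≟ n)

∑<-except : ∀ n c (g : ℕ → ℤ) → c < n → ∑[ d < n ] 𝟙 (not (c ≡ᵇ d)) * g d ≡ ∑< n g - g c
∑<-except (suc n) c g c<1+n with ℕₚ.m≤n⇒m<n∨m≡n (ℕₚ.≤-pred c<1+n)
... | inj₂ refl = begin
  (∑[ d < c ] 𝟙 (not (c ≡ᵇ d)) * g d) + 𝟙 (not (c ≡ᵇ c)) * g c
    ≡⟨ cong₂ _+_ (∑<-cong c (λ d d<c → trans (cong (λ b → 𝟙 (not b) * g d) (≡ᵇ-≢ (ℕₚ.<⇒≢ d<c ∘ sym)))
                                             (ℤₚ.*-identityˡ (g d))))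
                 (cong (λ b → 𝟙 (not b) * g c) (≡ᵇ-refl c)) ⟩
  ∑< c g + + 0 * g c ≡⟨ drop-0* (∑< c g) (g c) ⟩
  ∑< c g + g c - g c ∎
  where
  drop-0* : ∀ s y → s + + 0 * y ≡ s + y - y
  drop-0* = solve-∀
... | inj₁ c<n = begin
  (∑[ d < n ] 𝟙 (not (c ≡ᵇ d)) * g d) + 𝟙 (not (c ≡ᵇ n)) * g n
    ≡⟨ cong₂ _+_ (∑<-except n c g c<n) (cong (λ b → 𝟙 (not b) * g n) (≡ᵇ-≢ (ℕₚ.<⇒≢ c<n))) ⟩
  ∑< n g - g c + + 1 * g n ≡⟨ reorder (∑< n g) (g c) (g n) ⟩
  ∑< n g + g n - g c ∎
  where
  reorder : ∀ s y z → s - y + + 1 * z ≡ s + z - y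
  reorder = solve-∀

pathWeight : ℕ → (ℕ → ℤ) → ℕ → ℤ
pathWeight N x h = ∑[ d < N ] x d * legWeight N x h d

powerSum : ℕ → (ℕ → ℤ) → ℕ → ℤ
powerSum N x a = ∑[ c < N ] x c ^ suc a

module _ (N : ℕ) (x : ℕ → ℤ) where

  legWeight-suc : ∀ h c → c < N → legWeight N x (suc h) c ≡ pathWeight N x h - x c * legWeight N x h c
  legWeight-suc h c = ∑<-except N c (λ d → x d * legWeight N x h d)

  spiderWeight-[] : ∀ a → spiderWeight N x a [] ≡ powerSum N x a
  spiderWeight-[] a = ∑<-cong N (λ c _ → ℤₚ.*-identityʳ (x c ^ suc a))

  spiderWeight-0∷ : ∀ a ls → spiderWeight N x a (0 ∷ ls) ≡ spiderWeight N x a ls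
  spiderWeight-0∷ a ls = ∑<-cong N (λ c _ → cong (x c ^ suc a *_) (ℤₚ.*-identityˡ _))

  spiderWeight-suc∷ : ∀ a h ls → spiderWeight N x a (suc h ∷ ls)
                        ≡ pathWeight N x h * spiderWeight N x a ls - spiderWeight N x (suc a) (h ∷ ls)
  spiderWeight-suc∷ a h ls = begin
    ∑[ c < N ] x c ^ suc a * (legWeight N x (suc h) c * legsWeight N x ls c)
      ≡⟨ ∑<-cong N (λ c c<N → trans (cong (λ w → x c ^ suc a * (w * legsWeight N x ls c)) (legWeight-suc h c c<N))
                                    (expand (x c ^ suc a) (x c) (pathWeight N x h) (legWeight N x h c) (legsWeight N x ls c))) ⟩
    ∑[ c < N ] (P * (x c ^ suc a * legsWeight N x ls c) + - (x c ^ suc (suc a) * legsWeight N x (h ∷ ls) c))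
      ≡⟨ ∑<-+ N _ _ ⟩
    (∑[ c < N ] P * (x c ^ suc a * legsWeight N x ls c)) + (∑[ c < N ] - (x c ^ suc (suc a) * legsWeight N x (h ∷ ls) c))
      ≡⟨ cong₂ _+_ (∑<-*ˡ N P _) (∑<-neg N _) ⟩
    P * spiderWeight N x a ls - spiderWeight N x (suc a) (h ∷ ls) ∎
    where
    P = pathWeight N x h
    expand : ∀ q y p l r → q * ((p - y * l) * r) ≡ p * (q * r) + - (y * q * (l * r))
    expand = solve-∀

  pathWeight≡spiderWeight : ∀ h → pathWeight N x h ≡ spiderWeight N x 0 [ h ]
  pathWeight≡spiderWeight h = ∑<-cong N (λ d _ → pad (x d) (legWeight N x h d))
    where
    pad : ∀ a b → a * b ≡ a * + 1 * (b * + 1)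
    pad = solve-∀

-- Newton's identities

zeroAt : ℕ → (ℕ → ℤ) → ℕ → ℤ
zeroAt c x i = if i ≡ᵇ c then + 0 else x i

zeroAt-≢ : ∀ c x {i} → i ≢ c → zeroAt c x i ≡ x i
zeroAt-≢ c x ne rewrite ≡ᵇ-≢ ne = refl

zeroAt-self : ∀ c x → zeroAt c x c ≡ + 0
zeroAt-self c x rewrite ≡ᵇ-refl c = refl

elem-cong : ∀ j N {x y : ℕ → ℤ} → (∀ i → i < N → x i ≡ y i) → elem j N x ≡ elem j N y
elem-cong zero    N       e = refl
elem-cong (suc j) zero    e = refl
elem-cong (suc j) (suc N) e = cong₂ _+_ (elem-cong (suc j) N e′) (cong₂ _*_ (e N ℕₚ.≤-refl) (elem-cong j N e′))
  where
  e′ = λ i i<N → e i (ℕₚ.m<n⇒m<1+n i<N)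

elem-zeroAt-above : ∀ j N c x → N ≤ c → elem j N (zeroAt c x) ≡ elem j N x
elem-zeroAt-above j N c x N≤c = elem-cong j N (λ i i<N → zeroAt-≢ c x (ℕₚ.<⇒≢ (ℕₚ.<-≤-trans i<N N≤c)))

elem-zeroAt-last : ∀ j N x → elem j (suc N) (zeroAt N x) ≡ elem j N x
elem-zeroAt-last zero    N x = refl
elem-zeroAt-last (suc j) N x = begin
  elem (suc j) N (zeroAt N x) + zeroAt N x N * elem j N (zeroAt N x)
    ≡⟨ cong₂ (λ u v → u + v * elem j N (zeroAt N x)) (elem-zeroAt-above (suc j) N N x ℕₚ.≤-refl) (zeroAt-self N x) ⟩
  elem (suc j) N x + + 0 * elem j N (zeroAt N x)
    ≡⟨ drop-0* (elem (suc j) N x) (elem j N (zeroAt N x)) ⟩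
  elem (suc j) N x ∎
  where
  drop-0* : ∀ s y → s + + 0 * y ≡ s
  drop-0* = solve-∀

elem-zeroAt : ∀ j N c x → c < N → elem (suc j) N x ≡ elem (suc j) N (zeroAt c x) + x c * elem j N (zeroAt c x)
elem-zeroAt j (suc N) c x c<1+N with ℕₚ.m≤n⇒m<n∨m≡n (ℕₚ.≤-pred c<1+N)
... | inj₂ refl = sym (cong₂ (λ u v → u + x c * v) (elem-zeroAt-last (suc j) c x) (elem-zeroAt-last j c x))
... | inj₁ c<N  = begin
  elem (suc j) N x + x N * elem j N x
    ≡⟨ cong (_+ x N * elem j N x) (elem-zeroAt j N c x c<N) ⟩
  elem (suc j) N z + x c * elem j N z + x N * elem j N x
    ≡⟨ lower j ⟩
  elem (suc j) N z + x N * elem j N z + x c * elem j (suc N) z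
    ≡⟨ cong (λ w → elem (suc j) N z + w * elem j N z + x c * elem j (suc N) z) (sym (zeroAt-≢ c x (ℕₚ.<⇒≢ c<N ∘ sym))) ⟩
  elem (suc j) N z + z N * elem j N z + x c * elem j (suc N) z ∎
  where
  z = zeroAt c x
  lower : ∀ j → elem (suc j) N z + x c * elem j N z + x N * elem j N x
                  ≡ elem (suc j) N z + x N * elem j N z + x c * elem j (suc N) z
  lower zero    = swap₁ (elem 1 N z) (x c) (x N)
    where
    swap₁ : ∀ s u v → s + u * + 1 + v * + 1 ≡ s + v * + 1 + u * + 1
    swap₁ = solve-∀
  lower (suc j) = begin
    elem (2 ℕ.+ j) N z + x c * elem (suc j) N z + x N * elem (suc j) N x
      ≡⟨ cong (λ w → elem (2 ℕ.+ j) N z + x c * elem (suc j) N z + x N * w) (elem-zeroAt j N c x c<N) ⟩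
    elem (2 ℕ.+ j) N z + x c * elem (suc j) N z + x N * (elem (suc j) N z + x c * elem j N z)
      ≡⟨ swap₂ (elem (2 ℕ.+ j) N z) (x c) (x N) (elem (suc j) N z) (elem j N z) ⟩
    elem (2 ℕ.+ j) N z + x N * elem (suc j) N z + x c * (elem (suc j) N z + x N * elem j N z)
      ≡⟨ cong (λ w → elem (2 ℕ.+ j) N z + x N * elem (suc j) N z + x c * (elem (suc j) N z + w * elem j N z))
              (sym (zeroAt-≢ c x (ℕₚ.<⇒≢ c<N ∘ sym))) ⟩
    elem (2 ℕ.+ j) N z + x N * elem (suc j) N z + x c * elem (suc j) (suc N) z ∎
    where
    swap₂ : ∀ s u v p q → s + u * p + v * (p + u * q) ≡ s + v * p + u * (p + v * q)
    swap₂ = solve-∀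

∑-x*elem-zeroAt : ∀ j N x → ∑[ c < N ] x c * elem j N (zeroAt c x) ≡ + suc j * elem (suc j) N x
∑-x*elem-zeroAt j zero x = sym (ℤₚ.*-zeroʳ (+ suc j))
∑-x*elem-zeroAt zero (suc N) x = begin
  (∑[ c < N ] x c * + 1) + x N * + 1  ≡⟨ cong (_+ x N * + 1) (∑-x*elem-zeroAt zero N x) ⟩
  + 1 * elem 1 N x + x N * + 1        ≡⟨ factor (elem 1 N x) (x N) ⟩
  + 1 * (elem 1 N x + x N * + 1)      ∎
  where
  factor : ∀ s y → + 1 * s + y * + 1 ≡ + 1 * (s + y * + 1)
  factor = solve-∀
∑-x*elem-zeroAt (suc j) (suc N) x = begin
  (∑[ c < N ] x c * elem (suc j) (suc N) (zeroAt c x)) + x N * elem (suc j) (suc N) (zeroAt N x)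
    ≡⟨ cong₂ _+_ (∑<-cong N (λ c c<N → cong (λ w → x c * (elem (suc j) N (zeroAt c x) + w * elem j N (zeroAt c x)))
                                            (zeroAt-≢ c x (ℕₚ.<⇒≢ c<N ∘ sym))))
                 (cong (x N *_) (elem-zeroAt-last (suc j) N x)) ⟩
  (∑[ c < N ] x c * (elem (suc j) N (zeroAt c x) + x N * elem j N (zeroAt c x))) + x N * elem (suc j) N x
    ≡⟨ cong (_+ x N * elem (suc j) N x) (begin
         ∑[ c < N ] x c * (elem (suc j) N (zeroAt c x) + x N * elem j N (zeroAt c x))
           ≡⟨ ∑<-cong N (λ c _ → distrib (x c) (elem (suc j) N (zeroAt c x)) (x N) (elem j N (zeroAt c x))) ⟩
         ∑[ c < N ] (x c * elem (suc j) N (zeroAt c x) + x N * (x c * elem j N (zeroAt c x)))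
           ≡⟨ ∑<-+ N _ _ ⟩
         (∑[ c < N ] x c * elem (suc j) N (zeroAt c x)) + (∑[ c < N ] x N * (x c * elem j N (zeroAt c x)))
           ≡⟨ cong₂ _+_ (∑-x*elem-zeroAt (suc j) N x) (trans (∑<-*ˡ N (x N) _) (cong (x N *_) (∑-x*elem-zeroAt j N x))) ⟩
         + suc (suc j) * elem (2 ℕ.+ j) N x + x N * (+ suc j * elem (suc j) N x) ∎) ⟩
  + suc (suc j) * elem (2 ℕ.+ j) N x + x N * (+ suc j * elem (suc j) N x) + x N * elem (suc j) N x
    ≡⟨ collect (+ suc j) (elem (2 ℕ.+ j) N x) (x N) (elem (suc j) N x) ⟩
  + suc (suc j) * (elem (2 ℕ.+ j) N x + x N * elem (suc j) N x) ∎
  where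
  distrib : ∀ a u b v → a * (u + b * v) ≡ a * u + b * (a * v)
  distrib = solve-∀
  collect : ∀ s e y u → (+ 1 + s) * e + y * (s * u) + y * u ≡ (+ 1 + s) * (e + y * u)
  collect = solve-∀

newtonSum : ℕ → (ℕ → ℤ) → ℕ → ℕ → ℤ
newtonSum N x a j = ∑[ c < N ] x c ^ suc a * elem j N (zeroAt c x)

module _ (N : ℕ) (x : ℕ → ℤ) where

  powerSum≡newtonSum : ∀ a → powerSum N x a ≡ newtonSum N x a 0
  powerSum≡newtonSum a = ∑<-cong N (λ c _ → sym (ℤₚ.*-identityʳ (x c ^ suc a)))

  newtonSum-0 : ∀ j → newtonSum N x 0 j ≡ + suc j * elem (suc j) N x
  newtonSum-0 j = trans (∑<-cong N (λ c _ → cong (_* elem j N (zeroAt c x)) (ℤₚ.*-identityʳ (x c))))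
                        (∑-x*elem-zeroAt j N x)

  powerSum*elem : ∀ a j → powerSum N x a * elem (suc j) N x ≡ newtonSum N x a (suc j) + newtonSum N x (suc a) j
  powerSum*elem a j = begin
    powerSum N x a * E             ≡⟨ ℤₚ.*-comm (powerSum N x a) E ⟩
    E * powerSum N x a             ≡⟨ ∑<-*ˡ N E _ ⟨
    ∑[ c < N ] E * x c ^ suc a
      ≡⟨ ∑<-cong N (λ c c<N → trans (cong (_* x c ^ suc a) (elem-zeroAt j N c x c<N))
                                    (distrib (elem (suc j) N (zeroAt c x)) (x c) (elem j N (zeroAt c x)) (x c ^ suc a))) ⟩
    ∑[ c < N ] (x c ^ suc a * elem (suc j) N (zeroAt c x) + x c ^ suc (suc a) * elem j N (zeroAt c x))
      ≡⟨ ∑<-+ N _ _ ⟩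
    newtonSum N x a (suc j) + newtonSum N x (suc a) j ∎
    where
    E = elem (suc j) N x
    distrib : ∀ u y v p → (u + y * v) * p ≡ p * u + y * p * v
    distrib = solve-∀

  newtonSum-suc : ∀ a j → newtonSum N x (suc a) j ≡ powerSum N x a * elem (suc j) N x - newtonSum N x a (suc j)
  newtonSum-suc a j = sym (trans (cong (_- newtonSum N x a (suc j)) (powerSum*elem a j))
                                 (cancel (newtonSum N x a (suc j)) (newtonSum N x (suc a) j)))
    where
    cancel : ∀ u v → u + v - u ≡ v
    cancel = solve-∀

-- Formal polynomials in the e_k

-- A formal ℤ-linear combination of products e_μ: a list of (coefficient, μ) with μ in any order.
EPoly : Set
EPoly = List (ℤ × List ℕ)

infixl 7 _·ₚ_ _*ₚ_
infixl 6 _-ₚ_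

_·ₚ_ : ℤ → EPoly → EPoly
s ·ₚ F = map (λ (a , μ) → (s * a , μ)) F

_*ₚ_ : EPoly → EPoly → EPoly
F *ₚ G = concatMap (λ (a , μ) → map (λ (b , ν) → (a * b , μ ++ ν)) G) F

_-ₚ_ : EPoly → EPoly → EPoly
F -ₚ G = F ++ (- + 1) ·ₚ G

eₚ : ℕ → EPoly
eₚ k = [ (+ 1 , [ k ]) ]

⟦_⟧ᵗ : ℤ × List ℕ → ℕ → (ℕ → ℤ) → ℤ
⟦ (a , μ) ⟧ᵗ N x = a * eλ μ N x

⟦_⟧ : EPoly → ℕ → (ℕ → ℤ) → ℤ
⟦ F ⟧ N x = ∑[ t ∈ F ] ⟦ t ⟧ᵗ N x

newtonₚ : ℕ → ℕ → EPoly
newtonₚ zero    j = + suc j ·ₚ eₚ (suc j)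
newtonₚ (suc a) j = newtonₚ a 0 *ₚ eₚ (suc j) -ₚ newtonₚ a (suc j)

powerSumₚ : ℕ → EPoly
powerSumₚ a = newtonₚ a 0

pathₚ    : ℕ → EPoly
spiderₚ : ℕ → List ℕ → EPoly
legₚ    : ℕ → ℕ → List ℕ → EPoly
pathₚ h = legₚ 0 h []
spiderₚ a []       = powerSumₚ a
spiderₚ a (h ∷ ls) = legₚ a h ls
legₚ a zero    ls = spiderₚ a ls
legₚ a (suc h) ls = pathₚ h *ₚ spiderₚ a ls -ₚ legₚ (suc a) h ls

prodℤ-++ : ∀ xs ys → prodℤ (xs ++ ys) ≡ prodℤ xs * prodℤ ys
prodℤ-++ []       ys = sym (ℤₚ.*-identityˡ _)
prodℤ-++ (a ∷ xs) ys = trans (cong (a *_) (prodℤ-++ xs ys)) (sym (ℤₚ.*-assoc a _ _))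

module _ (N : ℕ) (x : ℕ → ℤ) where

  eλ-++ : ∀ μ ν → eλ (μ ++ ν) N x ≡ eλ μ N x * eλ ν N x
  eλ-++ μ ν = trans (cong prodℤ (map-++ (λ k → elem k N x) μ ν)) (prodℤ-++ (map (λ k → elem k N x) μ) _)

  ⟦⟧-++ : ∀ F G → ⟦ F ++ G ⟧ N x ≡ ⟦ F ⟧ N x + ⟦ G ⟧ N x
  ⟦⟧-++ F G = ∑∈-++ F G (λ t → ⟦ t ⟧ᵗ N x)

  ⟦⟧-· : ∀ s F → ⟦ s ·ₚ F ⟧ N x ≡ s * ⟦ F ⟧ N x
  ⟦⟧-· s F = trans (∑∈-map _ F (λ t → ⟦ t ⟧ᵗ N x))
                   (trans (∑∈-cong F (λ (a , μ) → ℤₚ.*-assoc s a _)) (∑∈-*ˡ F s (λ t → ⟦ t ⟧ᵗ N x)))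

  ⟦⟧-- : ∀ F G → ⟦ F -ₚ G ⟧ N x ≡ ⟦ F ⟧ N x - ⟦ G ⟧ N x
  ⟦⟧-- F G = trans (⟦⟧-++ F ((- + 1) ·ₚ G))
                   (cong (_+_ (⟦ F ⟧ N x)) (trans (⟦⟧-· (- + 1) G) (ℤₚ.-1*i≡-i (⟦ G ⟧ N x))))

  ⟦⟧-* : ∀ F G → ⟦ F *ₚ G ⟧ N x ≡ ⟦ F ⟧ N x * ⟦ G ⟧ N x
  ⟦⟧-* F G = begin
    ⟦ F *ₚ G ⟧ N x
      ≡⟨ ∑∈-concatMap _ F (λ t → ⟦ t ⟧ᵗ N x) ⟩
    ∑[ t ∈ F ] ∑∈ (map (λ (b , ν) → (proj₁ t * b , proj₂ t ++ ν)) G) (λ u → ⟦ u ⟧ᵗ N x)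
      ≡⟨ ∑∈-cong F (λ t → trans (∑∈-map _ G (λ u → ⟦ u ⟧ᵗ N x))
                                (trans (∑∈-cong G (term t)) (∑∈-*ˡ G (⟦ t ⟧ᵗ N x) (λ u → ⟦ u ⟧ᵗ N x)))) ⟩
    ∑[ t ∈ F ] ⟦ t ⟧ᵗ N x * ⟦ G ⟧ N x
      ≡⟨ ∑∈-*ʳ F (⟦ G ⟧ N x) (λ t → ⟦ t ⟧ᵗ N x) ⟩
    ⟦ F ⟧ N x * ⟦ G ⟧ N x ∎
    where
    regroup : ∀ a b p q → a * b * (p * q) ≡ a * p * (b * q)
    regroup = solve-∀
    term : ∀ t u → ⟦ (proj₁ t * proj₁ u , proj₂ t ++ proj₂ u) ⟧ᵗ N x ≡ ⟦ t ⟧ᵗ N x * ⟦ u ⟧ᵗ N x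
    term (a , μ) (b , ν) = trans (cong (a * b *_) (eλ-++ μ ν)) (regroup a b _ _)

  ⟦eₚ⟧ : ∀ k → ⟦ eₚ k ⟧ N x ≡ elem k N x
  ⟦eₚ⟧ k = simplify (elem k N x)
    where
    simplify : ∀ e → + 1 * (e * + 1) + + 0 ≡ e
    simplify = solve-∀

  ⟦newtonₚ⟧ : ∀ a j → ⟦ newtonₚ a j ⟧ N x ≡ newtonSum N x a j
  ⟦newtonₚ⟧ zero    j = begin
    ⟦ + suc j ·ₚ eₚ (suc j) ⟧ N x ≡⟨ ⟦⟧-· (+ suc j) (eₚ (suc j)) ⟩
    + suc j * ⟦ eₚ (suc j) ⟧ N x  ≡⟨ cong (+ suc j *_) (⟦eₚ⟧ (suc j)) ⟩
    + suc j * elem (suc j) N x    ≡⟨ newtonSum-0 N x j ⟨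
    newtonSum N x 0 j             ∎
  ⟦newtonₚ⟧ (suc a) j = begin
    ⟦ newtonₚ a 0 *ₚ eₚ (suc j) -ₚ newtonₚ a (suc j) ⟧ N x
      ≡⟨ ⟦⟧-- (newtonₚ a 0 *ₚ eₚ (suc j)) (newtonₚ a (suc j)) ⟩
    ⟦ newtonₚ a 0 *ₚ eₚ (suc j) ⟧ N x - ⟦ newtonₚ a (suc j) ⟧ N x
      ≡⟨ cong₂ _-_ (trans (⟦⟧-* (newtonₚ a 0) (eₚ (suc j)))
                          (cong₂ _*_ (trans (⟦newtonₚ⟧ a 0) (sym (powerSum≡newtonSum N x a))) (⟦eₚ⟧ (suc j))))
                   (⟦newtonₚ⟧ a (suc j)) ⟩
    powerSum N x a * elem (suc j) N x - newtonSum N x a (suc j)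
      ≡⟨ newtonSum-suc N x a j ⟨
    newtonSum N x (suc a) j ∎

  ⟦powerSumₚ⟧ : ∀ a → ⟦ powerSumₚ a ⟧ N x ≡ powerSum N x a
  ⟦powerSumₚ⟧ a = trans (⟦newtonₚ⟧ a 0) (sym (powerSum≡newtonSum N x a))

  ⟦pathₚ⟧   : ∀ h → ⟦ pathₚ h ⟧ N x ≡ pathWeight N x h
  ⟦spiderₚ⟧ : ∀ a ls → ⟦ spiderₚ a ls ⟧ N x ≡ spiderWeight N x a ls
  ⟦legₚ⟧    : ∀ a h ls → ⟦ legₚ a h ls ⟧ N x ≡ spiderWeight N x a (h ∷ ls)
  ⟦pathₚ⟧ h = trans (⟦legₚ⟧ 0 h []) (sym (pathWeight≡spiderWeight N x h))
  ⟦spiderₚ⟧ a []       = trans (⟦powerSumₚ⟧ a) (sym (spiderWeight-[] N x a))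
  ⟦spiderₚ⟧ a (h ∷ ls) = ⟦legₚ⟧ a h ls
  ⟦legₚ⟧ a zero    ls = trans (⟦spiderₚ⟧ a ls) (sym (spiderWeight-0∷ N x a ls))
  ⟦legₚ⟧ a (suc h) ls = begin
    ⟦ pathₚ h *ₚ spiderₚ a ls -ₚ legₚ (suc a) h ls ⟧ N x
      ≡⟨ ⟦⟧-- (pathₚ h *ₚ spiderₚ a ls) (legₚ (suc a) h ls) ⟩
    ⟦ pathₚ h *ₚ spiderₚ a ls ⟧ N x - ⟦ legₚ (suc a) h ls ⟧ N x
      ≡⟨ cong₂ _-_ (trans (⟦⟧-* (pathₚ h) (spiderₚ a ls)) (cong₂ _*_ (⟦pathₚ⟧ h) (⟦spiderₚ⟧ a ls)))
                   (⟦legₚ⟧ (suc a) h ls) ⟩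
    pathWeight N x h * spiderWeight N x a ls - spiderWeight N x (suc a) (h ∷ ls)
      ≡⟨ spiderWeight-suc∷ N x a h ls ⟨
    spiderWeight N x a (suc h ∷ ls) ∎

IsComposition : ℕ → List ℕ → Set
IsComposition n μ = sumℕ μ ≡ n × All (1 ≤_) μ

Homogeneous : ℕ → EPoly → Set
Homogeneous n F = All (IsComposition n ∘ proj₂) F

homogeneous-· : ∀ {n} s F → Homogeneous n F → Homogeneous n (s ·ₚ F)
homogeneous-· s F h = map⁺ (All.map (λ c → c) h)

homogeneous-- : ∀ {n} F G → Homogeneous n F → Homogeneous n G → Homogeneous n (F -ₚ G)
homogeneous-- F G hF hG = ++⁺ hF (homogeneous-· (- + 1) G hG)

isComposition-++ : ∀ {m n μ ν} → IsComposition m μ → IsComposition n ν → IsComposition (m ℕ.+ n) (μ ++ ν)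
isComposition-++ {μ = μ} {ν} (refl , pμ) (refl , pν) = sumℕ-++ μ ν , ++⁺ pμ pν
  where
  sumℕ-++ : ∀ μ ν → sumℕ (μ ++ ν) ≡ sumℕ μ ℕ.+ sumℕ ν
  sumℕ-++ []      ν = refl
  sumℕ-++ (a ∷ μ) ν = trans (cong (a ℕ.+_) (sumℕ-++ μ ν)) (sym (ℕₚ.+-assoc a _ _))

homogeneous-* : ∀ {m n} F G → Homogeneous m F → Homogeneous n G → Homogeneous (m ℕ.+ n) (F *ₚ G)
homogeneous-* []      G []        hG = []
homogeneous-* (t ∷ F) G (ht ∷ hF) hG = ++⁺ (map⁺ (All.map (isComposition-++ ht) hG)) (homogeneous-* F G hF hG)

homogeneous-eₚ : ∀ k → Homogeneous (suc k) (eₚ (suc k))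
homogeneous-eₚ k = (ℕₚ.+-identityʳ (suc k) , s≤s z≤n ∷ []) ∷ []

homogeneous-cast : ∀ {m n} F → m ≡ n → Homogeneous m F → Homogeneous n F
homogeneous-cast F refl h = h

homogeneous-newtonₚ : ∀ a j → Homogeneous (suc (a ℕ.+ j)) (newtonₚ a j)
homogeneous-newtonₚ zero    j = homogeneous-· (+ suc j) (eₚ (suc j)) (homogeneous-eₚ j)
homogeneous-newtonₚ (suc a) j = homogeneous-- (newtonₚ a 0 *ₚ eₚ (suc j)) (newtonₚ a (suc j))
  (homogeneous-cast (newtonₚ a 0 *ₚ eₚ (suc j)) (degree₁ a j)
    (homogeneous-* (newtonₚ a 0) (eₚ (suc j)) (homogeneous-newtonₚ a 0) (homogeneous-eₚ j)))
  (homogeneous-cast (newtonₚ a (suc j)) (degree₂ a j) (homogeneous-newtonₚ a (suc j)))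
  where
  degree₁ : ∀ a j → suc (a ℕ.+ 0) ℕ.+ suc j ≡ suc (suc a ℕ.+ j)
  degree₁ = ℕ-Solver.solve-∀
  degree₂ : ∀ a j → suc (a ℕ.+ suc j) ≡ suc (suc a ℕ.+ j)
  degree₂ = ℕ-Solver.solve-∀

homogeneous-pathₚ   : ∀ h → Homogeneous (suc h) (pathₚ h)
homogeneous-spiderₚ : ∀ a ls → Homogeneous (suc a ℕ.+ sumℕ ls) (spiderₚ a ls)
homogeneous-legₚ    : ∀ a h ls → Homogeneous (suc a ℕ.+ (h ℕ.+ sumℕ ls)) (legₚ a h ls)
homogeneous-pathₚ h = homogeneous-cast (legₚ 0 h []) (cong suc (ℕₚ.+-identityʳ h)) (homogeneous-legₚ 0 h [])
homogeneous-spiderₚ a [] = homogeneous-newtonₚ a 0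
homogeneous-spiderₚ a (h ∷ ls) = homogeneous-legₚ a h ls
homogeneous-legₚ a zero    ls = homogeneous-spiderₚ a ls
homogeneous-legₚ a (suc h) ls = homogeneous-- (pathₚ h *ₚ spiderₚ a ls) (legₚ (suc a) h ls)
  (homogeneous-cast (pathₚ h *ₚ spiderₚ a ls) (degree₁ a h (sumℕ ls))
    (homogeneous-* (pathₚ h) (spiderₚ a ls) (homogeneous-pathₚ h) (homogeneous-spiderₚ a ls)))
  (homogeneous-cast (legₚ (suc a) h ls) (degree₂ a h (sumℕ ls)) (homogeneous-legₚ (suc a) h ls))
  where
  degree₁ : ∀ a h s → suc h ℕ.+ (suc a ℕ.+ s) ≡ suc a ℕ.+ (suc h ℕ.+ s)
  degree₁ = ℕ-Solver.solve-∀
  degree₂ : ∀ a h s → suc (suc a) ℕ.+ (h ℕ.+ s) ≡ suc a ℕ.+ (suc h ℕ.+ s)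
  degree₂ = ℕ-Solver.solve-∀

infix 4 _==_

_==_ : List ℕ → List ℕ → Bool
[]       == []       = true
(a ∷ μ) == (b ∷ ν) = (a ≡ᵇ b) ∧ (μ == ν)
_        == _        = false

sum∷-nonincreasing : ∀ ν → Nonincreasing ν → Nonincreasing (sumℕ ν ∷ ν)
sum∷-nonincreasing []      _ = [-]
sum∷-nonincreasing (a ∷ ν) s = ℕₚ.m≤m+n a (sumℕ ν) ∷ s

∑-partsF-δ : ∀ f m n ν (g : List ℕ → ℤ) → Nonincreasing (m ∷ ν) → IsComposition n ν → n ≤ f →
  ∑[ μ ∈ partsF f m n ] (if ν == μ then g μ else + 0) ≡ g ν
∑-partsF-δ f       m zero    []          g _ _           _   = ℤₚ.+-identityʳ (g [])
∑-partsF-δ f       m zero    (zero ∷ ν)  g _ (_ , () ∷ _) _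
∑-partsF-δ f       m (suc n) []          g _ (() , _)    _
∑-partsF-δ zero    m (suc n) (_ ∷ _)     g _ _           ()
∑-partsF-δ (suc f) m (suc n) (zero ∷ ν)  g _ (_ , () ∷ _) _
∑-partsF-δ (suc f) m (suc n) (suc k ∷ ν) g (k<m ∷ sorted) (sum≡ , _ ∷ pos) (s≤s n≤f) = begin
  ∑∈ (concatMap (λ i → map (suc i ∷_) (rest i)) (upTo (m ⊓ suc n))) δ
    ≡⟨ ∑∈-concatMap (λ i → map (suc i ∷_) (rest i)) (upTo (m ⊓ suc n)) δ ⟩
  ∑[ i ∈ upTo (m ⊓ suc n) ] ∑∈ (map (suc i ∷_) (rest i)) δ
    ≡⟨ ∑∈-upTo (m ⊓ suc n) _ ⟩
  ∑[ i < m ⊓ suc n ] ∑∈ (map (suc i ∷_) (rest i)) δ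
    ≡⟨ ∑<-δ (m ⊓ suc n) k _ (ℕₚ.⊓-pres-m< k<m (s≤s k≤n)) other ⟩
  ∑∈ (map (suc k ∷_) (rest k)) δ
    ≡⟨ ∑∈-map (suc k ∷_) (rest k) δ ⟩
  ∑[ μ ∈ rest k ] (if (k ≡ᵇ k) ∧ (ν == μ) then g (suc k ∷ μ) else + 0)
    ≡⟨ cong (λ b → ∑[ μ ∈ rest k ] (if b ∧ (ν == μ) then g (suc k ∷ μ) else + 0)) (≡ᵇ-refl k) ⟩
  ∑[ μ ∈ rest k ] (if ν == μ then g (suc k ∷ μ) else + 0)
    ≡⟨ ∑-partsF-δ f (suc k) (suc n ∸ suc k) ν (g ∘ (suc k ∷_)) sorted (sum-rest , pos)
                  (ℕₚ.≤-trans (ℕₚ.m∸n≤m n k) n≤f) ⟩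
  g (suc k ∷ ν) ∎
  where
  rest : ℕ → List (List ℕ)
  rest i = partsF f (suc i) (suc n ∸ suc i)
  δ : List ℕ → ℤ
  δ μ = if suc k ∷ ν == μ then g μ else + 0
  sum-rest : sumℕ ν ≡ n ∸ k
  sum-rest = sym (trans (cong (_∸ k) (sym (ℕₚ.suc-injective sum≡))) (ℕₚ.m+n∸m≡n k (sumℕ ν)))
  k≤n : k ≤ n
  k≤n = subst (k ≤_) (ℕₚ.suc-injective sum≡) (ℕₚ.m≤m+n k (sumℕ ν))
  other : ∀ i → i < m ⊓ suc n → i ≢ k → ∑∈ (map (suc i ∷_) (rest i)) δ ≡ + 0
  other i _ i≢k = begin
    ∑∈ (map (suc i ∷_) (rest i)) δ
      ≡⟨ ∑∈-map (suc i ∷_) (rest i) δ ⟩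
    ∑[ μ ∈ rest i ] (if (k ≡ᵇ i) ∧ (ν == μ) then g (suc i ∷ μ) else + 0)
      ≡⟨ cong (λ b → ∑[ μ ∈ rest i ] (if b ∧ (ν == μ) then g (suc i ∷ μ) else + 0)) (≡ᵇ-≢ (i≢k ∘ sym)) ⟩
    ∑[ μ ∈ rest i ] + 0
      ≡⟨ ∑∈-0 (rest i) ⟩
    + 0 ∎

∑-partitions-δ : ∀ n ν (g : List ℕ → ℤ) → Nonincreasing ν → IsComposition n ν →
  ∑[ μ ∈ partitions n ] (if ν == μ then g μ else + 0) ≡ g ν
∑-partitions-δ n ν g sorted (refl , pos) =
  ∑-partsF-δ n n n ν g (sum∷-nonincreasing ν sorted) (refl , pos) ℕₚ.≤-refl

-- Sorting the parts of each term is what collects a formal sum by partitions.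
coeff : EPoly → List ℕ → ℤ
coeff F μ = ∑[ t ∈ F ] (if sort (proj₂ t) == μ then proj₁ t else + 0)

if-then-0-* : ∀ b (a e : ℤ) → (if b then a else + 0) * e ≡ (if b then a * e else + 0)
if-then-0-* true  a e = refl
if-then-0-* false a e = ℤₚ.*-zeroˡ e

*-if-then-0 : ∀ b (a e : ℤ) → a * (if b then e else + 0) ≡ (if b then a * e else + 0)
*-if-then-0 true  a e = refl
*-if-then-0 false a e = ℤₚ.*-zeroʳ a

prodℤ-↭ : ∀ {xs ys} → xs ↭ ys → prodℤ xs ≡ prodℤ ys
prodℤ-↭ p = foldr-commMonoid M.setoid M.isCommutativeMonoid (↭⇒↭ₛ p)
  where module M = CommutativeMonoid ℤₚ.*-1-commutativeMonoid

eλ-sort : ∀ ν N x → eλ (sort ν) N x ≡ eλ ν N x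
eλ-sort ν N x = prodℤ-↭ (↭.map⁺ (λ k → elem k N x) (sort-↭ ν))

isComposition-sort : ∀ {n} ν → IsComposition n ν → IsComposition n (sort ν)
isComposition-sort ν (sum≡ , pos) = trans (sum-↭ (sort-↭ ν)) sum≡ , ↭.All-resp-↭ (↭-sym (sort-↭ ν)) pos

∑-partitions-coeff : ∀ N x n F → Homogeneous n F → ∑[ μ ∈ partitions n ] coeff F μ * eλ μ N x ≡ ⟦ F ⟧ N x
∑-partitions-coeff N x n F hom = begin
  ∑[ μ ∈ partitions n ] coeff F μ * eλ μ N x
    ≡⟨ ∑∈-cong (partitions n) (λ μ → sym (∑∈-*ʳ F (eλ μ N x) (δ μ))) ⟩
  ∑[ μ ∈ partitions n ] ∑[ t ∈ F ] δ μ t * eλ μ N x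
    ≡⟨ ∑∈-comm (partitions n) F (λ μ t → δ μ t * eλ μ N x) ⟩
  ∑[ t ∈ F ] ∑[ μ ∈ partitions n ] δ μ t * eλ μ N x
    ≡⟨ ∑∈-cong-All F hom term ⟩
  ⟦ F ⟧ N x ∎
  where
  δ : List ℕ → ℤ × List ℕ → ℤ
  δ μ t = if sort (proj₂ t) == μ then proj₁ t else + 0
  term : ∀ t → IsComposition n (proj₂ t) → ∑[ μ ∈ partitions n ] δ μ t * eλ μ N x ≡ ⟦ t ⟧ᵗ N x
  term (a , ν) comp = begin
    ∑[ μ ∈ partitions n ] δ μ (a , ν) * eλ μ N x
      ≡⟨ ∑∈-cong (partitions n) (λ μ → if-then-0-* (sort ν == μ) a (eλ μ N x)) ⟩
    ∑[ μ ∈ partitions n ] (if sort ν == μ then a * eλ μ N x else + 0)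
      ≡⟨ ∑-partitions-δ n (sort ν) (λ μ → a * eλ μ N x) (sort-↗ ν) (isComposition-sort ν comp) ⟩
    a * eλ (sort ν) N x
      ≡⟨ cong (a *_) (eλ-sort ν N x) ⟩
    a * eλ ν N x ∎

spider-eExpansion : ∀ ls → All (1 ≤_) ls → IsEExpansion (spiderEdges ls) (spiderSize ls) (coeff (spiderₚ 0 ls))
spider-eExpansion ls pos x = begin
  chromX (spiderEdges ls) n n x                         ≡⟨ chromX-spider n x ls pos ⟩
  spiderWeight n x 0 ls                                 ≡⟨ ⟦spiderₚ⟧ n x 0 ls ⟨
  ⟦ spiderₚ 0 ls ⟧ n x                                  ≡⟨ ∑-partitions-coeff n x n (spiderₚ 0 ls) (homogeneous-spiderₚ 0 ls) ⟨
  ∑[ μ ∈ partitions n ] coeff (spiderₚ 0 ls) μ * eλ μ n x ∎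
  where
  n = spiderSize ls

-- Evaluation at (1, −1, 0, …)

signs : ℕ → ℤ
signs 0 = + 1
signs 1 = - + 1
signs _ = + 0

elem-signs : ∀ j N → 2 ≤ N → elem j N signs ≡ elem j 2 signs
elem-signs zero    N                   _ = refl
elem-signs (suc j) (suc zero)          (s≤s ())
elem-signs (suc j) (suc (suc zero))    _ = refl
elem-signs (suc j) (suc (suc (suc N))) _ =
  trans (cong (_+_ (elem (suc j) (suc (suc N)) signs)) (ℤₚ.*-zeroˡ (elem j (suc (suc N)) signs)))
        (trans (ℤₚ.+-identityʳ _) (elem-signs (suc j) (suc (suc N)) (s≤s (s≤s z≤n))))

eλ-signs : ∀ N → 2 ≤ N → ∀ k μ → IsComposition (2 ℕ.* k) μ →
  eλ μ N signs ≡ (if replicate k 2 == μ then negOnePow k else + 0)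
eλ-signs N 2≤N zero    []          _ = refl
eλ-signs N 2≤N (suc k) []          (() , _)
eλ-signs N 2≤N k       (zero ∷ μ) (_ , () ∷ _)
eλ-signs N 2≤N k       (1 ∷ μ)    _ =
  trans (cong (_* eλ μ N signs) (elem-signs 1 N 2≤N)) (trans (ℤₚ.*-zeroˡ (eλ μ N signs)) (other k))
  where
  other : ∀ k → + 0 ≡ (if replicate k 2 == 1 ∷ μ then negOnePow k else + 0)
  other zero    = refl
  other (suc k) = refl
eλ-signs N 2≤N k       (suc (suc (suc a)) ∷ μ) _ =
  trans (cong (_* eλ μ N signs) (elem-signs (3 ℕ.+ a) N 2≤N)) (trans (ℤₚ.*-zeroˡ (eλ μ N signs)) (other k))
  where
  other : ∀ k → + 0 ≡ (if replicate k 2 == 3 ℕ.+ a ∷ μ then negOnePow k else + 0)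
  other zero    = refl
  other (suc k) = refl
eλ-signs N 2≤N zero    (2 ∷ μ)    (() , _)
eλ-signs N 2≤N (suc k) (2 ∷ μ)    (sum≡ , _ ∷ pos) = begin
  elem 2 N signs * eλ μ N signs
    ≡⟨ cong₂ _*_ (elem-signs 2 N 2≤N) (eλ-signs N 2≤N k μ (sum-μ , pos)) ⟩
  - + 1 * (if replicate k 2 == μ then negOnePow k else + 0)
    ≡⟨ negate (replicate k 2 == μ) ⟩
  (if replicate k 2 == μ then - negOnePow k else + 0) ∎
  where
  sum-μ : sumℕ μ ≡ 2 ℕ.* k
  sum-μ = ℕₚ.suc-injective (ℕₚ.suc-injective (trans sum≡ (cong suc (ℕₚ.+-suc k (k ℕ.+ 0)))))
  negate : ∀ b → - + 1 * (if b then negOnePow k else + 0) ≡ (if b then - negOnePow k else + 0)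
  negate true  = ℤₚ.-1*i≡-i (negOnePow k)
  negate false = refl

partsF-isComposition : ∀ f m n → All (IsComposition n) (partsF f m n)
partsF-isComposition f       m zero    = (refl , []) ∷ []
partsF-isComposition zero    m (suc n) = []
partsF-isComposition (suc f) m (suc n) = concat⁺ (map⁺ (applyUpTo⁺₁ (λ i → i) (m ⊓ suc n) prepend))
  where
  prepend : ∀ {i} → i < m ⊓ suc n → All (IsComposition (suc n)) (map (suc i ∷_) (partsF f (suc i) (suc n ∸ suc i)))
  prepend {i} i<m⊓1+n = map⁺ (All.map (λ (sum≡ , pos) → trans (cong (suc i ℕ.+_) sum≡) (ℕₚ.m+[n∸m]≡n i≤n) , s≤s z≤n ∷ pos)
                                      (partsF-isComposition f (suc i) (suc n ∸ suc i)))
    where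
    i≤n : suc i ≤ suc n
    i≤n = ℕₚ.≤-trans i<m⊓1+n (ℕₚ.m⊓n≤n m (suc n))

replicate-2-nonincreasing : ∀ k → Nonincreasing (replicate k 2)
replicate-2-nonincreasing zero          = []
replicate-2-nonincreasing (suc zero)    = [-]
replicate-2-nonincreasing (suc (suc k)) = ℕₚ.≤-refl ∷ replicate-2-nonincreasing (suc k)

replicate-2-isComposition : ∀ k → IsComposition (2 ℕ.* k) (replicate k 2)
replicate-2-isComposition zero    = refl , []
replicate-2-isComposition (suc k) =
  trans (cong (2 ℕ.+_) (proj₁ (replicate-2-isComposition k))) (sym (cong suc (ℕₚ.+-suc k (k ℕ.+ 0)))) ,
  s≤s z≤n ∷ proj₂ (replicate-2-isComposition k)

∑-partitions-signs : ∀ N k → 2 ≤ N → N ≡ 2 ℕ.* k → (c : List ℕ → ℤ) →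
  ∑[ μ ∈ partitions N ] c μ * eλ μ N signs ≡ c (replicate k 2) * negOnePow k
∑-partitions-signs N k 2≤N refl c = begin
  ∑[ μ ∈ partitions N ] c μ * eλ μ N signs
    ≡⟨ ∑∈-cong-All (partitions N) (partsF-isComposition N N N) (λ μ comp →
         trans (cong (c μ *_) (eλ-signs N 2≤N k μ comp)) (*-if-then-0 (replicate k 2 == μ) (c μ) (negOnePow k))) ⟩
  ∑[ μ ∈ partitions N ] (if replicate k 2 == μ then c μ * negOnePow k else + 0)
    ≡⟨ ∑-partitions-δ N (replicate k 2) (λ μ → c μ * negOnePow k) (replicate-2-nonincreasing k) (replicate-2-isComposition k) ⟩
  c (replicate k 2) * negOnePow k ∎

negOnePow-+ : ∀ m n → negOnePow (m ℕ.+ n) ≡ negOnePow m * negOnePow n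
negOnePow-+ zero    n = sym (ℤₚ.*-identityˡ _)
negOnePow-+ (suc m) n = trans (cong -_ (negOnePow-+ m n)) (ℤₚ.neg-distribˡ-* (negOnePow m) (negOnePow n))

negOnePow-square : ∀ m → negOnePow m * negOnePow m ≡ + 1
negOnePow-square zero    = refl
negOnePow-square (suc m) = trans (neg*neg (negOnePow m)) (negOnePow-square m)
  where
  neg*neg : ∀ y → - y * - y ≡ y * y
  neg*neg = solve-∀

negOnePow-even : ∀ t → negOnePow (2 ℕ.* t) ≡ + 1
negOnePow-even t = trans (negOnePow-+ t (t ℕ.+ 0))
                         (trans (cong (λ m → negOnePow t * negOnePow m) (ℕₚ.+-identityʳ t)) (negOnePow-square t))

legWeight-signs : ∀ N → 2 ≤ N → ∀ l →
  legWeight N signs l 0 ≡ negOnePow ⌈ l /2⌉ × legWeight N signs l 1 ≡ negOnePow ⌊ l /2⌋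
legWeight-signs N 2≤N zero    = refl , refl
legWeight-signs N 2≤N (suc l) with legWeight-signs N 2≤N l
... | at0 , at1 =
  trans (∑<-first-two N 2≤N _ (vanish 0))
        (trans (cong₂ (λ u v → + 0 * (+ 1 * u) + + 1 * (- + 1 * v)) at0 at1) (collapse₀ (negOnePow ⌈ l /2⌉) (negOnePow ⌊ l /2⌋))) ,
  trans (∑<-first-two N 2≤N _ (vanish 1))
        (trans (cong₂ (λ u v → + 1 * (+ 1 * u) + + 0 * (- + 1 * v)) at0 at1) (collapse₁ (negOnePow ⌈ l /2⌉) (negOnePow ⌊ l /2⌋)))
  where
  vanish : ∀ c i → 𝟙 (not (c ≡ᵇ suc (suc i))) * (signs (suc (suc i)) * legWeight N signs l (suc (suc i))) ≡ + 0
  vanish c i = trans (cong (𝟙 (not (c ≡ᵇ suc (suc i))) *_) (ℤₚ.*-zeroˡ (legWeight N signs l (suc (suc i)))))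
                     (ℤₚ.*-zeroʳ (𝟙 (not (c ≡ᵇ suc (suc i)))))
  collapse₀ : ∀ u v → + 0 * (+ 1 * u) + + 1 * (- + 1 * v) ≡ - v
  collapse₀ = solve-∀
  collapse₁ : ∀ u v → + 1 * (+ 1 * u) + + 0 * (- + 1 * v) ≡ u
  collapse₁ = solve-∀

legsWeight-signs : ∀ N → 2 ≤ N → ∀ ls →
  legsWeight N signs ls 0 ≡ negOnePow (sumℕ (map ⌈_/2⌉ ls)) × legsWeight N signs ls 1 ≡ negOnePow (sumℕ (map ⌊_/2⌋ ls))
legsWeight-signs N 2≤N []       = refl , refl
legsWeight-signs N 2≤N (l ∷ ls) =
  trans (cong₂ _*_ (proj₁ (legWeight-signs N 2≤N l)) (proj₁ (legsWeight-signs N 2≤N ls))) (sym (negOnePow-+ ⌈ l /2⌉ _)) ,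
  trans (cong₂ _*_ (proj₂ (legWeight-signs N 2≤N l)) (proj₂ (legsWeight-signs N 2≤N ls))) (sym (negOnePow-+ ⌊ l /2⌋ _))

chromX-spider-signs : ∀ ls → All (1 ≤_) ls → ∀ N → 2 ≤ N →
  chromX (spiderEdges ls) (spiderSize ls) N signs ≡ negOnePow (sumℕ (map ⌈_/2⌉ ls)) - negOnePow (sumℕ (map ⌊_/2⌋ ls))
chromX-spider-signs ls pos N 2≤N = begin
  chromX (spiderEdges ls) (spiderSize ls) N signs
    ≡⟨ chromX-spider N signs ls pos ⟩
  ∑[ c < N ] signs c ^ 1 * legsWeight N signs ls c
    ≡⟨ ∑<-first-two N 2≤N _ (λ i → ℤₚ.*-zeroˡ (legsWeight N signs ls (suc (suc i)))) ⟩
  + 1 * + 1 * legsWeight N signs ls 0 + - + 1 * + 1 * legsWeight N signs ls 1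
    ≡⟨ cong₂ (λ u v → + 1 * + 1 * u + - + 1 * + 1 * v) (proj₁ (legsWeight-signs N 2≤N ls)) (proj₂ (legsWeight-signs N 2≤N ls)) ⟩
  + 1 * + 1 * negOnePow (sumℕ (map ⌈_/2⌉ ls)) + - + 1 * + 1 * negOnePow (sumℕ (map ⌊_/2⌋ ls))
    ≡⟨ simplify (negOnePow (sumℕ (map ⌈_/2⌉ ls))) (negOnePow (sumℕ (map ⌊_/2⌋ ls))) ⟩
  negOnePow (sumℕ (map ⌈_/2⌉ ls)) - negOnePow (sumℕ (map ⌊_/2⌋ ls)) ∎
  where
  simplify : ∀ u v → + 1 * + 1 * u + - + 1 * + 1 * v ≡ u - v
  simplify = solve-∀

parityBit : ℕ → ℕ
parityBit l = if l % 2 ≡ᵇ 1 then 1 else 0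

⌈n/2⌉≡⌊n/2⌋+parityBit : ∀ n → ⌈ n /2⌉ ≡ ⌊ n /2⌋ ℕ.+ parityBit n
⌈n/2⌉≡⌊n/2⌋+parityBit zero          = refl
⌈n/2⌉≡⌊n/2⌋+parityBit (suc zero)    = refl
⌈n/2⌉≡⌊n/2⌋+parityBit (suc (suc n)) = cong suc (⌈n/2⌉≡⌊n/2⌋+parityBit n)

sum-⌈/2⌉ : ∀ ls → sumℕ (map ⌈_/2⌉ ls) ≡ sumℕ (map ⌊_/2⌋ ls) ℕ.+ oddLegs ls
sum-⌈/2⌉ []       = refl
sum-⌈/2⌉ (l ∷ ls) = begin
  ⌈ l /2⌉ ℕ.+ sumℕ (map ⌈_/2⌉ ls)
    ≡⟨ cong₂ ℕ._+_ (⌈n/2⌉≡⌊n/2⌋+parityBit l) (sum-⌈/2⌉ ls) ⟩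
  ⌊ l /2⌋ ℕ.+ parityBit l ℕ.+ (sumℕ (map ⌊_/2⌋ ls) ℕ.+ oddLegs ls)
    ≡⟨ interchange ⌊ l /2⌋ (parityBit l) (sumℕ (map ⌊_/2⌋ ls)) (oddLegs ls) ⟩
  ⌊ l /2⌋ ℕ.+ sumℕ (map ⌊_/2⌋ ls) ℕ.+ (parityBit l ℕ.+ oddLegs ls) ∎
  where
  interchange : ∀ p q r s → p ℕ.+ q ℕ.+ (r ℕ.+ s) ≡ p ℕ.+ r ℕ.+ (q ℕ.+ s)
  interchange = ℕ-Solver.solve-∀

sum-⌊/2⌋+sum-⌈/2⌉ : ∀ ls → sumℕ (map ⌊_/2⌋ ls) ℕ.+ sumℕ (map ⌈_/2⌉ ls) ≡ sumℕ ls
sum-⌊/2⌋+sum-⌈/2⌉ []       = refl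
sum-⌊/2⌋+sum-⌈/2⌉ (l ∷ ls) = begin
  ⌊ l /2⌋ ℕ.+ sumℕ (map ⌊_/2⌋ ls) ℕ.+ (⌈ l /2⌉ ℕ.+ sumℕ (map ⌈_/2⌉ ls))
    ≡⟨ interchange ⌊ l /2⌋ (sumℕ (map ⌊_/2⌋ ls)) ⌈ l /2⌉ (sumℕ (map ⌈_/2⌉ ls)) ⟩
  ⌊ l /2⌋ ℕ.+ ⌈ l /2⌉ ℕ.+ (sumℕ (map ⌊_/2⌋ ls) ℕ.+ sumℕ (map ⌈_/2⌉ ls))
    ≡⟨ cong₂ ℕ._+_ (ℕₚ.⌊n/2⌋+⌈n/2⌉≡n l) (sum-⌊/2⌋+sum-⌈/2⌉ ls) ⟩
  l ℕ.+ sumℕ ls ∎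
  where
  interchange : ∀ p q r s → p ℕ.+ q ℕ.+ (r ℕ.+ s) ≡ p ℕ.+ r ℕ.+ (q ℕ.+ s)
  interchange = ℕ-Solver.solve-∀

data Parity : ℕ → Set where
  even : ∀ t → Parity (2 ℕ.* t)
  odd : ∀ t → Parity (suc (2 ℕ.* t))

parity : ∀ n → Parity n
parity zero = even 0
parity (suc n) with parity n
... | even t = odd t
... | odd t = subst Parity (2*suc t) (even (suc t))
  where
  2*suc : ∀ t → 2 ℕ.* suc t ≡ suc (suc (2 ℕ.* t))
  2*suc = ℕ-Solver.solve-∀

sign-equation : ∀ a t (c : ℤ) → c * negOnePow (a ℕ.+ suc t) ≡ negOnePow (a ℕ.+ suc (2 ℕ.* t)) - negOnePow a →
  c ≡ negOnePow t * + 2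
sign-equation a t c eq = begin
  c
    ≡⟨ trans (cong (c *_) (cong₂ _*_ (negOnePow-square a) (negOnePow-square t))) (ℤₚ.*-identityʳ c) ⟨
  c * (P * P * (T * T))
    ≡⟨ regroup c P T ⟩
  c * (P * - T) * (P * - T)
    ≡⟨ cong (_* (P * - T)) eq′ ⟩
  (- P - P) * (P * - T)
    ≡⟨ expand P T ⟩
  P * P * (T + T)
    ≡⟨ cong (_* (T + T)) (negOnePow-square a) ⟩
  + 1 * (T + T)
    ≡⟨ double T ⟩
  T * + 2 ∎
  where
  P = negOnePow a
  T = negOnePow t
  eq′ : c * (P * - T) ≡ - P - P
  eq′ = trans (cong (c *_) (sym (negOnePow-+ a (suc t))))
              (trans eq (cong (_- P) (trans (negOnePow-+ a (suc (2 ℕ.* t)))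
                                            (trans (cong (λ z → P * - z) (negOnePow-even t))
                                                   (trans (ℤₚ.*-comm P (- + 1)) (ℤₚ.-1*i≡-i P))))))
  regroup : ∀ c p q → c * (p * p * (q * q)) ≡ c * (p * - q) * (p * - q)
  regroup = solve-∀
  expand : ∀ p q → (- p - p) * (p * - q) ≡ p * p * (q + q)
  expand = solve-∀
  double : ∀ q → + 1 * (q + q) ≡ q * + 2
  double = solve-∀

coefficient-from-signs : ∀ a j k (c : ℤ) → suc (a ℕ.+ (a ℕ.+ j)) ≡ 2 ℕ.* k →
  c * negOnePow k ≡ negOnePow (a ℕ.+ j) - negOnePow a → c ≡ negOnePow ((j ∸ 1) / 2) * + 2
coefficient-from-signs a j k c size eq with parity j
... | even t = ⊥-elim (ℕₚ.even≢odd k (a ℕ.+ t) (sym (trans (regroup a t) size)))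
  where
  regroup : ∀ a t → suc (2 ℕ.* (a ℕ.+ t)) ≡ suc (a ℕ.+ (a ℕ.+ 2 ℕ.* t))
  regroup = ℕ-Solver.solve-∀
... | odd t = begin
  c                                  ≡⟨ sign-equation a t c (subst (λ m → c * negOnePow m ≡ _) k≡ eq) ⟩
  negOnePow t * + 2                  ≡⟨ cong (λ m → negOnePow m * + 2) half ⟨
  negOnePow ((2 ℕ.* t) / 2) * + 2    ∎
  where
  half : (2 ℕ.* t) / 2 ≡ t
  half = trans (cong (_/ 2) (ℕₚ.*-comm 2 t)) (ℕ.m*n/n≡m t 2)
  regroup : ∀ a t → suc (a ℕ.+ (a ℕ.+ suc (2 ℕ.* t))) ≡ 2 ℕ.* (a ℕ.+ suc t)
  regroup = ℕ-Solver.solve-∀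
  k≡ : k ≡ a ℕ.+ suc t
  k≡ = ℕₚ.*-cancelˡ-≡ k (a ℕ.+ suc t) 2 (trans (sym size) (regroup a t))

suc≡2*⇒2≤suc : ∀ {m k} → suc m ≡ 2 ℕ.* k → 2 ≤ suc m
suc≡2*⇒2≤suc {k = zero}  ()
suc≡2*⇒2≤suc {k = suc k} e = subst (2 ≤_) (sym e) (ℕₚ.*-monoʳ-≤ 2 (s≤s z≤n))

spider-coefficient : ∀ ls → All (1 ≤_) ls → ∀ k → spiderSize ls ≡ 2 ℕ.* k → ∀ c →
  IsEExpansion (spiderEdges ls) (spiderSize ls) c → c (replicate k 2) ≡ negOnePow ((oddLegs ls ∸ 1) / 2) * + 2
spider-coefficient ls pos k size c expansion = coefficient-from-signs a (oddLegs ls) k (c (replicate k 2)) degree (begin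
  c (replicate k 2) * negOnePow k             ≡⟨ ∑-partitions-signs n k 2≤n size c ⟨
  ∑[ μ ∈ partitions n ] c μ * eλ μ n signs  ≡⟨ expansion signs ⟨
  chromX (spiderEdges ls) n n signs           ≡⟨ chromX-spider-signs ls pos n 2≤n ⟩
  negOnePow b - negOnePow a                   ≡⟨ cong (λ m → negOnePow m - negOnePow a) (sum-⌈/2⌉ ls) ⟩
  negOnePow (a ℕ.+ oddLegs ls) - negOnePow a ∎)
  where
  n = spiderSize ls
  a = sumℕ (map ⌊_/2⌋ ls)
  b = sumℕ (map ⌈_/2⌉ ls)
  2≤n : 2 ≤ n
  2≤n = suc≡2*⇒2≤suc {k = k} size
  degree : suc (a ℕ.+ (a ℕ.+ oddLegs ls)) ≡ 2 ℕ.* k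
  degree = trans (cong (λ m → suc (a ℕ.+ m)) (sym (sum-⌈/2⌉ ls))) (trans (cong suc (sum-⌊/2⌋+sum-⌈/2⌉ ls)) size)

lemma5p2 : (ls : List ℕ) → All (λ l → 1 ≤ l) ls → Nonincreasing ls →
    (k : ℕ) → spiderSize ls ≡ 2 ℕ.* k →
    Σ (List ℕ → ℤ) (IsEExpansion (spiderEdges ls) (spiderSize ls))
    × ((c : List ℕ → ℤ) → IsEExpansion (spiderEdges ls) (spiderSize ls) c →
       c (replicate k 2) ≡ negOnePow ((oddLegs ls ∸ 1) / 2) ℤ.* + 2)
lemma5p2 ls pos _ k size = (coeff (spiderₚ 0 ls) , spider-eExpansion ls pos) , spider-coefficient ls pos k size
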